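{- Let $n\ge 3$. The poset $\Lambda(n)$ is autonomous, and $G_{\Lambda(n)}$ is the unique simple pseudo-graph $G$ on vertex set $[n]$ such that $\mathfrak{S}(G)=\{\Lambda(n)\}$.
   Context: A simple pseudo-graph is a finite graph that may have loops but no multiple edges; its edge set $E(G)\subseteq V(G)\times V(G)$ is a symmetric relation, and $v$ is looped iff $vv\in E(G)$. Write $N(v)=\{w: vw\in E(G)\}$. An OSP-graph is a simple pseudo-graph whose vertex set is a finite set of positive integers with the usual order. Pressing a looped vertex $v$ produces $G_{(v)}$ with vertex set $V(G)$ and edge set $E(G)\,\triangle\,(N(v)\times N(v))$; $G_{(v_1,\dots,v_k)}$ denotes successive pressing. A successful pressing sequence is a sequence $(v_1,\dots,v_k)$ with each $v_i$ looped in $G_{(v_1,\dots,v_{i-1})}$ and $G_{(v_1,\dots,v_k)}$ having no edges and no loops; $\Sigma(G)$ is their set. $G$ is full-rank if its adjacency matrix (diagonal entry $1$ at looped vertices) is invertible over $\mathbb{F}_2$. For full-rank $G$ on $n$ vertices and $\sigma=(v_1,\dots,v_n)\in\Sigma(G)$, let $U$ be the upper-triangular $0/1$ matrix with $U[i,j]=1$ iff $i\le j$ and $v_iv_j\in E(G_{(v_1,\dots,v_{i-1})})$, $D$ the digraph on $V(G)$ with arc $v_i\to v_j$ whenever $U[i,j]=1$, and $\mathcal{P}(G,\sigma)=(V(G),\preceq)$ the instructional poset with $y\preceq x$ iff there is a directed path (possibly of length $0$) from $x$ to $y$ in $D$. $\mathfrak{S}(G)=\{\mathcal{P}(G,\sigma):\sigma\in\Sigma(G)\}$.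 A linear extension of a poset is a listing $(\tau_1,\dots,\tau_n)$ of its elements with $\tau_i\succ\tau_j\Rightarrow i<j$; $\mathrm{LinExt}(\mathcal{P})$ is their set. A finite poset $\mathcal{P}$ is autonomous if there exist a full-rank OSP-graph $G$ and $\sigma\in\Sigma(G)$ with $\mathcal{P}(G,\sigma)$ isomorphic to $\mathcal{P}$ and $\Sigma(G)=\mathrm{LinExt}(\mathcal{P}(G,\sigma))$. $\Lambda(n)$ is the poset on $[n]=\{1,\dots,n\}$ whose cover relations are: $i$ covers $i+1$ for all $i\in[n-2]$, and $n-2$ covers $n$ (two minimal elements $n-1,n$ below a chain $1\succ 2\succ\cdots\succ n-2$). $G_{\Lambda(n)}$ is the OSP-graph with vertex set $[n]$ whose edges are $\{i,i+1\}$ for $i\in[n-1]$, the edge $\{n-2,n\}$, and a loop at $1$ (no other loops). -}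

module Defs where

open import Data.Nat using (ℕ; zero; suc; _+_; _∸_; _≤_; _<_)
open import Data.Sum using (_⊎_)
open import Data.Nat.Properties using () renaming (_≟_ to _≟ℕ_)
open import Data.Bool using (Bool; true; false; _∧_; _∨_; _xor_)
open import Data.Fin using (Fin; toℕ) renaming (_<_ to _<ᶠ_; _≤_ to _≤ᶠ_)
open import Data.List using (List; []; _∷_; length; lookup; take)
open import Data.List.Membership.Propositional using (_∈_)
open import Data.List.Relation.Unary.Unique.Propositional using (Unique)
open import Data.Product using (Σ; ∃; ∃-syntax; _×_; _,_)
open import Relation.Nullary using (¬_)
open import Relation.Nullary.Decidable using (⌊_⌋)
open import Relation.Binary.PropositionalEquality using (_≡_; _≢_)
open import Relation.Binary.Construct.Closure.ReflexiveTransitive using (Star)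
open import Function.Bundles using (_↔_; Inverse; _⇔_)

-- Simple pseudo-graphs on the vertex set Fin n (vertex i ↔ integer toℕ i + 1).
-- A graph is given by its adjacency function; A x x ≡ true means x is looped.

Adj : ℕ → Set
Adj n = Fin n → Fin n → Bool

SymmetricAdj : ∀ {n} → Adj n → Set
SymmetricAdj A = ∀ x y → A x y ≡ A y x

press : ∀ {n} → Adj n → Fin n → Adj n
press A v x y = A x y xor (A v x ∧ A v y)

pressSeq : ∀ {n} → Adj n → List (Fin n) → Adj n
pressSeq A []       = A
pressSeq A (v ∷ vs) = pressSeq (press A v) vs

Empty : ∀ {n} → Adj n → Set
Empty A = ∀ x y → A x y ≡ false

data Successful {n} : Adj n → List (Fin n) → Set where
  done  : ∀ {A} → Empty A → Successful A []
  step  : ∀ {A v vs} → A v v ≡ true → Successful (press A v) vs → Successful A (v ∷ vs)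

sumF2 : ∀ {n} → (Fin n → Bool) → Bool
sumF2 {zero}  f = false
sumF2 {suc n} f = f Fin.zero xor sumF2 (λ i → f (Fin.suc i))

matMul : ∀ {n} → Adj n → Adj n → Adj n
matMul A B i j = sumF2 (λ k → A i k ∧ B k j)

idMat : ∀ {n} → Adj n
idMat i j = ⌊ toℕ i ≟ℕ toℕ j ⌋

FullRank : ∀ {n} → Adj n → Set
FullRank {n} A = ∃[ B ] ((∀ i j → matMul A B i j ≡ idMat i j) × (∀ i j → matMul B A i j ≡ idMat i j))

-- Positions in σ are Fin (length σ); position i
-- corresponds to paper index i+1, and G_(v1..v_{i-1}) = pressSeq A (take i σ).

Arc : ∀ {n} → Adj n → List (Fin n) → Fin n → Fin n → Set
Arc A σ x y = Σ (Fin (length σ)) λ i → Σ (Fin (length σ)) λ j →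
  (i ≤ᶠ j) × (lookup σ i ≡ x) × (lookup σ j ≡ y) ×
  (pressSeq A (take (toℕ i) σ) x y ≡ true)

-- Order of the instructional poset P(G,σ):  instr A σ y x  means  y ⪯ x,
-- i.e. there is a directed path (possibly of length 0) from x to y in D.
instr : ∀ {n} → Adj n → List (Fin n) → Fin n → Fin n → Set
instr A σ y x = Star (Arc A σ) x y

-- Posets are represented by their order relation  R y x  meaning  y ⪯ x.

LinExt : ∀ {n} → (Fin n → Fin n → Set) → List (Fin n) → Set
LinExt {n} R τ = Unique τ × (∀ x → x ∈ τ) ×
  (∀ (i j : Fin (length τ)) → R (lookup τ j) (lookup τ i) → lookup τ i ≢ lookup τ j → i <ᶠ j)

PosetIso : ∀ {m n} → (Fin m → Fin m → Set) → (Fin n → Fin n → Set) → Set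
PosetIso {m} {n} P Q = Σ (Fin m ↔ Fin n) λ f →
  ∀ x y → P y x ⇔ Q (Inverse.to f y) (Inverse.to f x)

-- Autonomous poset: some full-rank OSP-graph G (vertex set relabelled
-- order-preservingly as Fin m) and σ ∈ Σ(G) with P(G,σ) ≅ P and
-- Σ(G) = LinExt(P(G,σ)).
Autonomous : ∀ {n} → (Fin n → Fin n → Set) → Set
Autonomous {n} P = Σ ℕ λ m → Σ (Adj m) λ A → Σ (List (Fin m)) λ σ →
  SymmetricAdj A × FullRank A × Successful A σ ×
  PosetIso (instr A σ) P ×
  (∀ τ → Successful A τ ⇔ LinExt (instr A σ) τ)

-- Λ(n): vertex x has label toℕ x + 1.  Covers x y ("x covers y"):
--   label x = i ∈ [n-2] and label y = i+1,  or  label x = n-2 and label y = n.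
LamCover : (n : ℕ) → Fin n → Fin n → Set
LamCover n x y =
  ((suc (toℕ x) ≤ n ∸ 2) × (suc (toℕ y) ≡ suc (suc (toℕ x))))
  ⊎ ((suc (toℕ x) ≡ n ∸ 2) × (suc (toℕ y) ≡ n))

Lam : (n : ℕ) → Fin n → Fin n → Set
Lam n y x = Star (LamCover n) x y

-- 𝔖(G) = {Λ(n)}: Σ(G) is nonempty and every σ ∈ Σ(G) yields P(G,σ) = Λ(n)
-- (equal as orders on the same vertex set [n]).
SfrakIsLam : (n : ℕ) → Adj n → Set
SfrakIsLam n A = (∃[ σ ] Successful A σ) ×
  (∀ σ → Successful A σ → ∀ x y → instr A σ y x ⇔ Lam n y x)

-- G_Λ(n): edges {i,i+1} (i ∈ [n-1]), {n-2,n}, and a loop at 1.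
GLam : (n : ℕ) → Adj n
GLam n x y =
  ⌊ suc (toℕ y) ≟ℕ suc (suc (toℕ x)) ⌋ ∨ ⌊ suc (toℕ x) ≟ℕ suc (suc (toℕ y)) ⌋ ∨
  (⌊ suc (toℕ x) ≟ℕ n ∸ 2 ⌋ ∧ ⌊ suc (toℕ y) ≟ℕ n ⌋) ∨
  (⌊ suc (toℕ y) ≟ℕ n ∸ 2 ⌋ ∧ ⌊ suc (toℕ x) ≟ℕ n ⌋) ∨
  (⌊ toℕ x ≟ℕ 0 ⌋ ∧ ⌊ toℕ y ≟ℕ 0 ⌋)

-- Pressing vertex 1 of G_Λ(n) leaves G_Λ(n−1) on the remaining vertices (two looped isolated
-- vertices when n = 3), while Λ(n) is Λ(n−1) with a new top element. By induction, every successful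
-- sequence of G_Λ(n) is 1 followed by one of G_Λ(n−1), its instructional poset is Λ(n), the successful
-- sequences are exactly the linear extensions of Λ(n), and the inverse matrix is built along the way.
--
-- Conversely, if 𝔖(G) = {Λ(n)} then every successful sequence starts at the top element 1; pressing it
-- leaves a graph whose only instructional poset is Λ(n−1), which by induction is what pressing 1 leaves
-- of G_Λ(n), so G is determined by the neighbourhood of 1. That neighbourhood contains 1 and 2. A further neighbour j is
-- impossible: G is then a Gram matrix Σ w wᵀ over F₂ whose rows are the first row of G and the rows of
-- the triangular factor of G_Λ(n−1), and replacing four of these rows by their images under the
-- orthogonal matrix J − I gives a triangular decomposition whose elimination order starts at j.

module Submission where

open import Defs
open import Data.Bool using (Bool; true; false; not; _∧_; _∨_; _xor_; T)
open import Data.Bool.Properties using (T-∧; ∧-comm; ∧-zeroʳ; xor-same; xor-identityʳ; xor-comm; ∧-identityʳ; ∨-zeroʳ; ¬-not) renaming (_≟_ to _≟ᵇ_)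
open import Data.Empty using (⊥; ⊥-elim)
open import Data.Fin using (Fin; zero; suc; toℕ)
import Data.Fin as Fin
open import Data.Fin.Properties using (suc-injective; 0≢1+n; all?; toℕ<n) renaming (_≟_ to _≟ᶠ_)
open import Data.List using (List; []; _∷_; _++_; map; length; lookup)
open import Data.List.Membership.Propositional using (_∈_; _∉_)
open import Data.List.Membership.Propositional.Properties using (∈-lookup; ∈-map⁺; ∈-map⁻)
open import Data.List.Relation.Binary.Permutation.Propositional using (_↭_; ↭-sym)
import Data.List.Relation.Binary.Permutation.Propositional as ↭
open import Data.List.Relation.Binary.Permutation.Propositional.Properties using (shift; shifts)
open import Data.List.Relation.Unary.All using (All; []; _∷_) renaming (lookup to All-lookup; tabulate to All-tabulate; map to All-map)
open import Data.List.Relation.Unary.AllPairs using (AllPairs; []; _∷_)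
import Data.List.Relation.Unary.AllPairs as AllPairs
open import Data.List.Relation.Unary.AllPairs.Properties using () renaming (map⁻ to AllPairs-map⁻; ++⁺ to AllPairs-++⁺)
open import Data.List.Relation.Unary.Unique.Propositional.Properties using () renaming (map⁻ to Unique-map⁻)
open import Data.List.Relation.Unary.All.Properties.Core using (¬Any⇒All¬)
open import Data.List.Relation.Unary.All.Properties using () renaming (++⁺ to All-++⁺; ++⁻ to All-++⁻)
open import Data.List.Relation.Unary.Any using (here; there; index)
open import Data.List.Relation.Unary.Any.Properties using (lookup-index)
open import Data.List.Relation.Unary.Unique.Propositional using (Unique)
open import Data.Nat using (ℕ; zero; suc; _+_; _∸_; _≡ᵇ_; _≤_; _<_; z≤n; s≤s)
open import Data.Nat.Properties using (≤-pred; <-cmp; m≤n⇒∃[o]m+o≡n; ≤-antisym; +-identityʳ; +-suc; m≤m+n; <⇒≢; >⇒≢; ≤-refl; ≤-trans; <⇒≤; n≤1+n) renaming (suc-injective to suc-injective′; _≟_ to _≟ℕ_)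
open import Data.Product using (Σ; ∃-syntax; _×_; _,_; proj₁; proj₂)
open import Data.Sum using (_⊎_; inj₁; inj₂)
open import Data.Unit using (tt)
open import Function.Base using (_∘_)
open import Function.Bundles using (_⇔_; mk⇔; Equivalence)
open import Function.Construct.Composition using () renaming (equivalence to ⇔-trans)
open import Function.Construct.Symmetry using (⇔-sym)
open import Function.Construct.Identity using (↔-id)
open import Relation.Binary.Construct.Closure.ReflexiveTransitive using (Star; ε; _◅_) renaming (map to Star-map; gmap to Star-gmap)
open import Relation.Binary.PropositionalEquality using (_≡_; _≢_; refl; sym; trans; cong; cong₂; subst; module ≡-Reasoning)
open import Relation.Nullary using (Dec; yes; no)
open import Relation.Binary.Definitions using (tri<; tri≈; tri>)
open import Relation.Nullary.Decidable using (⌊_⌋; toWitness; from-yes; isYes≗does; dec-true; dec-false)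

BoolFun : ℕ → Set
BoolFun zero    = Bool
BoolFun (suc n) = Bool → BoolFun n

Agree : ∀ n → BoolFun n → BoolFun n → Set
Agree zero    f g = f ≡ g
Agree (suc n) f g = ∀ b → Agree n (f b) (g b)

agree? : ∀ n → BoolFun n → BoolFun n → Bool
agree? zero    f g = ⌊ f ≟ᵇ g ⌋
agree? (suc n) f g = agree? n (f true) (g true) ∧ agree? n (f false) (g false)

truthTable : ∀ n {f g : BoolFun n} → T (agree? n f g) → Agree n f g
truthTable zero {f} {g} ok = toWitness {a? = f ≟ᵇ g} ok
truthTable (suc n) {f} {g} ok b
  with Equivalence.to (T-∧ {agree? n (f true) (g true)} {agree? n (f false) (g false)}) ok
truthTable (suc n) ok true  | ok₁ , _ = truthTable n ok₁
truthTable (suc n) ok false | _ , ok₀ = truthTable n ok₀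

_≋_ : ∀ {n} → Adj n → Adj n → Set
A ≋ B = ∀ x y → A x y ≡ B x y

≋-sym : ∀ {n} {A B : Adj n} → A ≋ B → B ≋ A
≋-sym e x y = sym (e x y)

≋-trans : ∀ {n} {A B C : Adj n} → A ≋ B → B ≋ C → A ≋ C
≋-trans e f x y = trans (e x y) (f x y)

press-cong : ∀ {n} {A B : Adj n} v → A ≋ B → press A v ≋ press B v
press-cong v e x y rewrite e x y | e v x | e v y = refl

Successful-resp : ∀ {n} {A B : Adj n} {σ} → A ≋ B → Successful A σ → Successful B σ
Successful-resp e (done empty) = done (λ x y → trans (sym (e x y)) (empty x y))
Successful-resp e (step {v = v} loop s) = step (trans (sym (e v v)) loop) (Successful-resp (press-cong v e) s)

press-symmetric : ∀ {n} {A : Adj n} v → SymmetricAdj A → SymmetricAdj (press A v)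
press-symmetric {A = A} v sym-A x y rewrite sym-A x y | ∧-comm (A v x) (A v y) = refl

Isolated : ∀ {n} → Adj n → Fin n → Set
Isolated A v = ∀ y → A v y ≡ false

press-isolates : ∀ {n} {A : Adj n} v → A v v ≡ true → Isolated (press A v) v
press-isolates {A = A} v loop y rewrite loop = xor-same (A v y)

press-keeps-isolated : ∀ {n} {A : Adj n} v w → SymmetricAdj A → Isolated A v → Isolated (press A w) v
press-keeps-isolated v w sym-A iso y rewrite iso y | sym-A w v | iso w = refl

isolated∉ : ∀ {n} {A : Adj n} {σ} v → SymmetricAdj A → Isolated A v → Successful A σ → v ∉ σ
isolated∉ v sym-A iso (step loop s) (here refl) with trans (sym loop) (iso v)
... | ()
isolated∉ v sym-A iso (step {v = w} loop s) (there v∈) =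
  isolated∉ v (press-symmetric w sym-A) (press-keeps-isolated v w sym-A iso) s v∈

pressed∉rest : ∀ {n} {A : Adj n} {v vs} → SymmetricAdj A → Successful A (v ∷ vs) → v ∉ vs
pressed∉rest {A = A} {v = v} sym-A (step loop s) =
  isolated∉ v (press-symmetric v sym-A) (press-isolates {A = A} v loop) s

Successful⇒Unique : ∀ {n} {A : Adj n} {σ} → SymmetricAdj A → Successful A σ → Unique σ
Successful⇒Unique sym-A (done _) = []
Successful⇒Unique sym-A s@(step {v = v} {vs} _ s′) =
  ¬Any⇒All¬ vs (pressed∉rest sym-A s) ∷ Successful⇒Unique (press-symmetric v sym-A) s′

-- Defs.Arc by recursion on the pressing sequence instead of by positions in it.
data Arc′ {n} : Adj n → List (Fin n) → Fin n → Fin n → Set where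
  first : ∀ {A v vs y} → A v y ≡ true → y ∈ v ∷ vs → Arc′ A (v ∷ vs) v y
  later : ∀ {A v vs x y} → Arc′ (press A v) vs x y → Arc′ A (v ∷ vs) x y

Path : ∀ {n} → Adj n → List (Fin n) → Fin n → Fin n → Set
Path A σ = Star (Arc′ A σ)

Arc⇒Arc′ : ∀ {n} {A : Adj n} σ {x y} → Arc A σ x y → Arc′ A σ x y
Arc⇒Arc′ (v ∷ vs) (zero , j , _ , refl , refl , e) = first e (∈-lookup j)
Arc⇒Arc′ (v ∷ vs) (suc i , suc j , s≤s i≤j , refl , refl , e) = later (Arc⇒Arc′ vs (i , j , i≤j , refl , refl , e))

Arc′⇒Arc : ∀ {n} {A : Adj n} {σ x y} → Arc′ A σ x y → Arc A σ x y
Arc′⇒Arc (first e y∈) = zero , index y∈ , z≤n , refl , sym (lookup-index y∈) , e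
Arc′⇒Arc (later a) with Arc′⇒Arc a
... | i , j , i≤j , σi , σj , e = suc i , suc j , s≤s i≤j , σi , σj , e

instr⇔Path : ∀ {n} {A : Adj n} {σ x y} → instr A σ y x ⇔ Path A σ x y
instr⇔Path {σ = σ} = mk⇔ (Star-map (Arc⇒Arc′ σ)) (Star-map Arc′⇒Arc)

Arc′-resp : ∀ {n} {A B : Adj n} {σ x y} → A ≋ B → Arc′ A σ x y → Arc′ B σ x y
Arc′-resp {x = x} {y} e (first a y∈) = first (trans (sym (e x y)) a) y∈
Arc′-resp e (later {v = v} a) = later (Arc′-resp (press-cong v e) a)

Arc′-source∈ : ∀ {n} {A : Adj n} {σ x y} → Arc′ A σ x y → x ∈ σ
Arc′-source∈ (first _ _) = here refl
Arc′-source∈ (later a) = there (Arc′-source∈ a)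

Arc′-target∈ : ∀ {n} {A : Adj n} {σ x y} → Arc′ A σ x y → y ∈ σ
Arc′-target∈ (first _ y∈) = y∈
Arc′-target∈ (later a) = there (Arc′-target∈ a)

Path-target : ∀ {n} {A : Adj n} {σ x y} → Path A σ x y → x ≡ y ⊎ y ∈ σ
Path-target ε = inj₁ refl
Path-target (a ◅ p) with Path-target p
... | inj₁ refl = inj₂ (Arc′-target∈ a)
... | inj₂ y∈ = inj₂ y∈

Path-peel : ∀ {n} {A : Adj n} {v vs x y} → v ∉ vs → x ≢ v → Path A (v ∷ vs) x y → Path (press A v) vs x y
Path-peel v∉ x≢v ε = ε
Path-peel v∉ x≢v (first _ _ ◅ p) = ⊥-elim (x≢v refl)
Path-peel v∉ x≢v (later a ◅ p) = a ◅ Path-peel v∉ (λ { refl → v∉ (Arc′-target∈ a) }) p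

Path-to-first : ∀ {n} {A : Adj n} {v vs x} → v ∉ vs → Path A (v ∷ vs) x v → x ≡ v
Path-to-first {v = v} {x = x} v∉ p with x ≟ᶠ v
... | yes x≡v = x≡v
... | no x≢v with Path-target (Path-peel v∉ x≢v p)
...   | inj₁ x≡v = x≡v
...   | inj₂ v∈ = ⊥-elim (v∉ v∈)

-- R y x reads y ⪯ x; no element of τ lies strictly below a later one.
Ordered : ∀ {n} → (Fin n → Fin n → Set) → List (Fin n) → Set
Ordered R = AllPairs (λ v w → R v w → v ≡ w)

IndexOrdered : ∀ {n} → (Fin n → Fin n → Set) → List (Fin n) → Set
IndexOrdered R τ = ∀ (i j : Fin (length τ)) → R (lookup τ j) (lookup τ i) → lookup τ i ≢ lookup τ j → toℕ i < toℕ j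

Ordered⇒IndexOrdered : ∀ {n} {R : Fin n → Fin n → Set} τ → Ordered R τ → IndexOrdered R τ
Ordered⇒IndexOrdered (v ∷ vs) o zero zero r v≢v = ⊥-elim (v≢v refl)
Ordered⇒IndexOrdered (v ∷ vs) o zero (suc j) r _ = s≤s z≤n
Ordered⇒IndexOrdered (v ∷ vs) (v↑ ∷ o) (suc i) zero r ne = ⊥-elim (ne (sym (All-lookup v↑ (∈-lookup i) r)))
Ordered⇒IndexOrdered (v ∷ vs) (_ ∷ o) (suc i) (suc j) r ne = s≤s (Ordered⇒IndexOrdered vs o i j r ne)

IndexOrdered⇒Ordered : ∀ {n} {R : Fin n → Fin n → Set} τ → IndexOrdered R τ → Ordered R τ
IndexOrdered⇒Ordered [] _ = []
IndexOrdered⇒Ordered {R = R} (v ∷ vs) ord =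
  All-tabulate head-maximal ∷ IndexOrdered⇒Ordered vs (λ i j r ne → ≤-pred (ord (suc i) (suc j) r ne))
  where
  head-maximal : ∀ {w} → w ∈ vs → R v w → v ≡ w
  head-maximal {w} w∈ r with v ≟ᶠ w
  ... | yes v≡w = v≡w
  ... | no v≢w with ord (suc (index w∈)) zero (subst (R v) (lookup-index w∈) r)
                        (λ e → v≢w (trans (sym e) (sym (lookup-index w∈))))
  ...   | ()

Ordered-mono : ∀ {n} {R R′ : Fin n → Fin n → Set} τ →
  (∀ {a b} → a ∈ τ → b ∈ τ → R′ a b → R a b) → Ordered R τ → Ordered R′ τ
Ordered-mono [] _ [] = []
Ordered-mono (v ∷ vs) R′⊆R (v↑ ∷ o) =
  All-tabulate (λ w∈ r → All-lookup v↑ w∈ (R′⊆R (here refl) (there w∈) r)) ∷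
  Ordered-mono vs (λ a∈ b∈ → R′⊆R (there a∈) (there b∈)) o

Successful⇒Ordered : ∀ {n} {A : Adj n} {τ} → SymmetricAdj A → Successful A τ → Ordered (λ y x → Path A τ x y) τ
Successful⇒Ordered sym-A (done _) = []
Successful⇒Ordered {A = A} sym-A s@(step {v = v} {vs} _ s′) =
  All-tabulate (λ _ p → sym (Path-to-first v∉ p)) ∷
  Ordered-mono vs (λ _ b∈ → Path-peel v∉ (λ { refl → v∉ b∈ })) (Successful⇒Ordered (press-symmetric v sym-A) s′)
  where
  v∉ : v ∉ vs
  v∉ = pressed∉rest sym-A s

addIsolated : ∀ {n} → Adj n → Adj (suc n)
addIsolated B zero    _       = false
addIsolated B (suc x) zero    = false
addIsolated B (suc x) (suc y) = B x y

addIsolated-cong : ∀ {n} {B B′ : Adj n} → B ≋ B′ → addIsolated B ≋ addIsolated B′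
addIsolated-cong e zero    y       = refl
addIsolated-cong e (suc x) zero    = refl
addIsolated-cong e (suc x) (suc y) = e x y

press-addIsolated : ∀ {n} (B : Adj n) v → press (addIsolated B) (suc v) ≋ addIsolated (press B v)
press-addIsolated B v zero    y       = refl
press-addIsolated B v (suc x) zero    = ∧-zeroʳ (B v x)
press-addIsolated B v (suc x) (suc y) = refl

Successful-addIsolated⁺ : ∀ {n} {B : Adj n} {τ} → Successful B τ → Successful (addIsolated B) (map suc τ)
Successful-addIsolated⁺ (done empty) = done λ { zero y → refl ; (suc x) zero → refl ; (suc x) (suc y) → empty x y }
Successful-addIsolated⁺ {B = B} (step {v = v} loop s) =
  step loop (Successful-resp (≋-sym (press-addIsolated B v)) (Successful-addIsolated⁺ s))

Successful-addIsolated⁻ : ∀ {n} {B : Adj n} {σ} → Successful (addIsolated B) σ →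
  ∃[ τ ] (σ ≡ map suc τ × Successful B τ)
Successful-addIsolated⁻ (done empty) = [] , refl , done (λ x y → empty (suc x) (suc y))
Successful-addIsolated⁻ (step {v = zero} () _)
Successful-addIsolated⁻ {B = B} (step {v = suc v} loop s)
  with Successful-addIsolated⁻ {B = press B v} (Successful-resp (press-addIsolated B v) s)
... | τ , refl , s′ = v ∷ τ , refl , step loop s′

zero∉map-suc : ∀ {n} (τ : List (Fin n)) → zero ∉ map suc τ
zero∉map-suc τ z∈ with ∈-map⁻ Fin.suc z∈
... | _ , _ , ()

suc∈map-suc : ∀ {n} {y : Fin n} {τ} → suc y ∈ map suc τ → y ∈ τ
suc∈map-suc y∈ with ∈-map⁻ Fin.suc y∈
... | _ , y∈′ , refl = y∈′

Arc′-addIsolated⁻ : ∀ {n} {B : Adj n} τ {x y} → Arc′ (addIsolated B) (map suc τ) (suc x) (suc y) → Arc′ B τ x y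
Arc′-addIsolated⁻ (v ∷ τ) (first a y∈) = first a (suc∈map-suc y∈)
Arc′-addIsolated⁻ {B = B} (v ∷ τ) (later a) = later (Arc′-addIsolated⁻ τ (Arc′-resp (press-addIsolated B v) a))

Arc′-addIsolated⁺ : ∀ {n} {B : Adj n} {τ x y} → Arc′ B τ x y → Arc′ (addIsolated B) (map suc τ) (suc x) (suc y)
Arc′-addIsolated⁺ (first a y∈) = first a (∈-map⁺ Fin.suc y∈)
Arc′-addIsolated⁺ {B = B} (later {v = v} a) = later (Arc′-resp (≋-sym (press-addIsolated B v)) (Arc′-addIsolated⁺ a))

attach : ∀ {n} → Adj n → (Fin (suc n) → Bool) → Adj (suc n)
attach B r x y = addIsolated B x y xor (r x ∧ r y)

attach-cong : ∀ {n} {B B′ : Adj n} {r r′ : Fin (suc n) → Bool} → B ≋ B′ → (∀ x → r x ≡ r′ x) →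
  attach B r ≋ attach B′ r′
attach-cong e e′ x y = cong₂ _xor_ (addIsolated-cong e x y) (cong₂ _∧_ (e′ x) (e′ y))

press-attach : ∀ {n} (B : Adj n) {r} → r zero ≡ true → press (attach B r) zero ≋ addIsolated B
press-attach B {r} r₀ x y rewrite r₀ = xor-cancelʳ (addIsolated B x y) (r x ∧ r y)
  where
  xor-cancelʳ : ∀ a c → (a xor c) xor (true ∧ c) ≡ a
  xor-cancelʳ = truthTable 2 tt

≋attach : ∀ {n} {A : Adj (suc n)} {B : Adj n} → press A zero ≋ addIsolated B → A ≋ attach B (A zero)
≋attach {A = A} reduces x y = begin
  A x y                                                ≡⟨ truthTable 2 {λ a c → a} {λ a c → (a xor c) xor c} tt (A x y) (A zero x ∧ A zero y) ⟩
  press A zero x y xor (A zero x ∧ A zero y)           ≡⟨ cong (_xor (A zero x ∧ A zero y)) (reduces x y) ⟩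
  attach _ (A zero) x y                                ∎
  where open ≡-Reasoning

module FirstPressed {n} {A : Adj (suc n)} {B : Adj n} (reduces : press A zero ≋ addIsolated B) where

  Successful-cons : ∀ {τ} → A zero zero ≡ true → Successful B τ → Successful A (zero ∷ map suc τ)
  Successful-cons loop s = step loop (Successful-resp (≋-sym reduces) (Successful-addIsolated⁺ s))

  Successful-uncons : ∀ {vs} → Successful A (zero ∷ vs) → ∃[ τ ] (vs ≡ map suc τ × Successful B τ)
  Successful-uncons (step _ s) = Successful-addIsolated⁻ (Successful-resp reduces s)

  Path-from-suc : ∀ {τ a w} → Path A (zero ∷ map suc τ) (suc a) w → Σ (Fin n) λ b → w ≡ suc b × Path B τ a b
  Path-from-suc ε = _ , refl , ε
  Path-from-suc {τ} (later {y = zero} arc ◅ p) = ⊥-elim (zero∉map-suc τ (Arc′-target∈ arc))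
  Path-from-suc {τ} (later {y = suc b} arc ◅ p) with Path-from-suc p
  ... | c , w≡ , q = c , w≡ , Arc′-addIsolated⁻ τ (Arc′-resp reduces arc) ◅ q

  Path-shift⇔ : ∀ {τ a b} → Path A (zero ∷ map suc τ) (suc a) (suc b) ⇔ Path B τ a b
  Path-shift⇔ = mk⇔ to (Star-gmap Fin.suc (λ arc → later (Arc′-resp (≋-sym reduces) (Arc′-addIsolated⁺ arc))))
    where
    to : ∀ {τ a b} → Path A (zero ∷ map suc τ) (suc a) (suc b) → Path B τ a b
    to p with Path-from-suc p
    ... | _ , refl , q = q

LamCover⇒< : ∀ N {x y : Fin N} → LamCover N x y → toℕ x < toℕ y
LamCover⇒< N {x} {y} = cover⇒< N (toℕ x) (toℕ y)
  where
  cover⇒< : ∀ N a b → ((suc a ≤ N ∸ 2) × (suc b ≡ suc (suc a))) ⊎ ((suc a ≡ N ∸ 2) × (suc b ≡ N)) → a < b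
  cover⇒< N a b (inj₁ (_ , refl)) = ≤-refl
  cover⇒< (suc (suc N)) a b (inj₂ (refl , refl)) = n≤1+n _

Lam⇒≤ : ∀ {N} {x y : Fin N} → Lam N y x → toℕ x ≤ toℕ y
Lam⇒≤ ε = ≤-refl
Lam⇒≤ {N} (c ◅ p) = ≤-trans (<⇒≤ (LamCover⇒< N c)) (Lam⇒≤ p)

Lam-below-zero : ∀ {N} {w : Fin (suc N)} → Lam (suc N) zero w → w ≡ zero
Lam-below-zero {w = zero} _ = refl
Lam-below-zero {w = suc w} p with Lam⇒≤ p
... | ()

Lam2-discrete : ∀ {x y : Fin 2} → Lam 2 y x → x ≡ y
Lam2-discrete ε = refl
Lam2-discrete (inj₁ (() , _) ◅ _)
Lam2-discrete (inj₂ (() , _) ◅ _)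

LamCover-shift⇔ : ∀ k {a b : Fin (2 + k)} → LamCover (3 + k) (suc a) (suc b) ⇔ LamCover (2 + k) a b
LamCover-shift⇔ k = mk⇔
  (λ { (inj₁ (s≤s le , e)) → inj₁ (le , suc-injective′ e) ; (inj₂ (e₁ , e₂)) → inj₂ (suc-injective′ e₁ , suc-injective′ e₂) })
  (λ { (inj₁ (le , e)) → inj₁ (s≤s le , cong suc e) ; (inj₂ (e₁ , e₂)) → inj₂ (cong suc e₁ , cong suc e₂) })

Lam-shift⇔ : ∀ k {a b : Fin (2 + k)} → Lam (3 + k) (suc b) (suc a) ⇔ Lam (2 + k) b a
Lam-shift⇔ k = mk⇔ to (Star-gmap Fin.suc (Equivalence.from (LamCover-shift⇔ k)))
  where
  from-suc : ∀ {a w} → Star (LamCover (3 + k)) (suc a) w → Σ (Fin (2 + k)) λ b → w ≡ suc b × Lam (2 + k) b a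
  from-suc ε = _ , refl , ε
  from-suc (_◅_ {j = zero} c p) with LamCover⇒< (3 + k) c
  ... | ()
  from-suc (_◅_ {j = suc _} c p) with from-suc p
  ... | b , w≡ , q = b , w≡ , Equivalence.to (LamCover-shift⇔ k) c ◅ q
  to : ∀ {a b} → Lam (3 + k) (suc b) (suc a) → Lam (2 + k) b a
  to p with from-suc p
  ... | _ , refl , q = q

Lam-zero-greatest : ∀ m (y : Fin (3 + m)) → Lam (3 + m) y zero
Lam-zero-greatest zero    zero             = ε
Lam-zero-greatest zero    (suc zero)       = inj₁ (s≤s z≤n , refl) ◅ ε
Lam-zero-greatest zero    (suc (suc zero)) = inj₂ (refl , refl) ◅ ε
Lam-zero-greatest (suc m) zero             = ε
Lam-zero-greatest (suc m) (suc y)          =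
  inj₁ (s≤s z≤n , refl) ◅ Equivalence.from (Lam-shift⇔ (suc m)) (Lam-zero-greatest m y)

InstrIs : ∀ {n} → Adj n → List (Fin n) → (Fin n → Fin n → Set) → Set
InstrIs A σ R = ∀ x y → Path A σ x y ⇔ R y x

Successful-starts-zero : ∀ {m} {A : Adj (3 + m)} {σ} → SymmetricAdj A → Successful A σ →
  InstrIs A σ (Lam (3 + m)) → ∃[ vs ] (σ ≡ zero ∷ vs)
Successful-starts-zero {m} {σ = []} _ _ instr
  with Path-target (Equivalence.from (instr zero (suc zero)) (Lam-zero-greatest m (suc zero)))
... | inj₁ ()
... | inj₂ ()
Successful-starts-zero {m} {σ = v ∷ vs} sym-A s instr
  with Path-to-first (pressed∉rest sym-A s) (Equivalence.from (instr zero v) (Lam-zero-greatest m v))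
... | refl = vs , refl

InstrIs-Lam-covers : ∀ {m} {A : Adj (3 + m)} {vs} → InstrIs A (zero ∷ vs) (Lam (3 + m)) → ∀ x → x ∈ zero ∷ vs
InstrIs-Lam-covers {m} instr x with Path-target (Equivalence.from (instr zero x) (Lam-zero-greatest m x))
... | inj₁ refl = here refl
... | inj₂ x∈ = x∈

module _ {m} {A : Adj (3 + m)} {B : Adj (2 + m)} (reduces : press A zero ≋ addIsolated B) where
  open FirstPressed {A = A} {B = B} reduces

  InstrIs-uncons : ∀ {τ} → InstrIs A (zero ∷ map suc τ) (Lam (3 + m)) → InstrIs B τ (Lam (2 + m))
  InstrIs-uncons instr a b = ⇔-trans (⇔-sym Path-shift⇔) (⇔-trans (instr (suc a) (suc b)) (Lam-shift⇔ m))

  InstrIs-cons : ∀ {τ} → InstrIs B τ (Lam (2 + m)) → (∀ b → Path A (zero ∷ map suc τ) zero (suc b)) →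
    InstrIs A (zero ∷ map suc τ) (Lam (3 + m))
  InstrIs-cons instr reach zero    zero    = mk⇔ (λ _ → ε) (λ _ → ε)
  InstrIs-cons instr reach zero    (suc b) = mk⇔ (λ _ → Lam-zero-greatest m (suc b)) (λ _ → reach b)
  InstrIs-cons instr reach (suc a) zero    = mk⇔ (λ p → ⊥-elim (0≢1+n (proj₁ (proj₂ (Path-from-suc p)))))
                                                 (λ l → ⊥-elim (0≢1+n (sym (Lam-below-zero l))))
  InstrIs-cons instr reach (suc a) (suc b) = ⇔-trans Path-shift⇔ (⇔-trans (instr a b) (⇔-sym (Lam-shift⇔ m)))

  Path-from-zero : ∀ {τ c b} → (∀ x → x ∈ τ) → A zero (suc c) ≡ true → Path B τ c b →
    Path A (zero ∷ map suc τ) zero (suc b)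
  Path-from-zero covers e p = first e (there (∈-map⁺ Fin.suc (covers _))) ◅ Equivalence.from Path-shift⇔ p

isZero : ∀ {n} → Fin n → Bool
isZero zero    = true
isZero (suc _) = false

upToOne : ∀ {n} → Fin n → Bool
upToOne zero    = true
upToOne (suc i) = isZero i

loops2 : Adj 2
loops2 zero       zero       = true
loops2 zero       (suc _)    = false
loops2 (suc _)    zero       = false
loops2 (suc zero) (suc zero) = true

-- What remains of G_Λ(3+m) once its vertex 1 is pressed.
GLam⁻ : ∀ m → Adj (2 + m)
GLam⁻ zero    = loops2
GLam⁻ (suc m) = GLam (3 + m)

topRow : ∀ m → Fin (3 + m) → Bool
topRow zero    = λ _ → true
topRow (suc m) = upToOne

topRow-zero : ∀ m → topRow m zero ≡ true
topRow-zero zero    = refl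
topRow-zero (suc m) = refl

_≋?_ : ∀ {n} (A B : Adj n) → Dec (A ≋ B)
A ≋? B = all? λ x → all? λ y → A x y ≟ᵇ B x y

-- GLam on labels, with _≡ᵇ_ in place of ⌊ _≟_ ⌋, which does not reduce under suc.
glam : ℕ → ℕ → ℕ → Bool
glam n a b =
  (suc b ≡ᵇ suc (suc a)) ∨ (suc a ≡ᵇ suc (suc b)) ∨
  ((suc a ≡ᵇ n ∸ 2) ∧ (suc b ≡ᵇ n)) ∨
  ((suc b ≡ᵇ n ∸ 2) ∧ (suc a ≡ᵇ n)) ∨
  ((a ≡ᵇ 0) ∧ (b ≡ᵇ 0))

⌊≟⌋≡ᵇ : ∀ a b → ⌊ a ≟ℕ b ⌋ ≡ (a ≡ᵇ b)
⌊≟⌋≡ᵇ a b = isYes≗does (a ≟ℕ b)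

GLam≡glam : ∀ n (x y : Fin n) → GLam n x y ≡ glam n (toℕ x) (toℕ y)
GLam≡glam n x y
  rewrite ⌊≟⌋≡ᵇ (suc (toℕ y)) (suc (suc (toℕ x))) | ⌊≟⌋≡ᵇ (suc (toℕ x)) (suc (suc (toℕ y)))
        | ⌊≟⌋≡ᵇ (suc (toℕ x)) (n ∸ 2) | ⌊≟⌋≡ᵇ (suc (toℕ y)) n | ⌊≟⌋≡ᵇ (suc (toℕ y)) (n ∸ 2)
        | ⌊≟⌋≡ᵇ (suc (toℕ x)) n | ⌊≟⌋≡ᵇ (toℕ x) 0 | ⌊≟⌋≡ᵇ (toℕ y) 0 = refl

glam-shift : ∀ m a b → glam (4 + m) (suc a) (suc b) ≡ glam (3 + m) a b xor ((a ≡ᵇ 0) ∧ (b ≡ᵇ 0))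
glam-shift zero    zero    zero    = refl
glam-shift (suc m) zero    zero    = refl
glam-shift m       zero    (suc b) = sym (xor-identityʳ _)
glam-shift m       (suc a) b       = sym (xor-identityʳ _)

isZero≡ : ∀ {n} (i : Fin n) → isZero i ≡ (toℕ i ≡ᵇ 0)
isZero≡ zero    = refl
isZero≡ (suc i) = refl

GLam-attach : ∀ m → GLam (3 + m) ≋ attach (GLam⁻ m) (topRow m)
GLam-attach zero = from-yes (GLam 3 ≋? attach loops2 (topRow 0))
GLam-attach (suc m) zero    zero          = refl
GLam-attach (suc m) zero    (suc zero)    = refl
GLam-attach (suc m) zero    (suc (suc k)) = trans (GLam≡glam (4 + m) zero (suc (suc k))) (cong (_∨ false) (∧-zeroʳ _))
GLam-attach (suc m) (suc zero)    zero    = refl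
GLam-attach (suc m) (suc (suc i)) zero    = trans (GLam≡glam (4 + m) (suc (suc i)) zero) (cong (_∨ false) (∧-zeroʳ _))
GLam-attach (suc m) (suc i) (suc k) = begin
  GLam (4 + m) (suc i) (suc k)                                ≡⟨ GLam≡glam (4 + m) (suc i) (suc k) ⟩
  glam (4 + m) (suc (toℕ i)) (suc (toℕ k))                    ≡⟨ glam-shift m (toℕ i) (toℕ k) ⟩
  glam (3 + m) (toℕ i) (toℕ k) xor ((toℕ i ≡ᵇ 0) ∧ (toℕ k ≡ᵇ 0)) ≡⟨ cong₂ (λ g z → g xor z) (sym (GLam≡glam (3 + m) i k)) (sym (cong₂ _∧_ (isZero≡ i) (isZero≡ k))) ⟩
  GLam (3 + m) i k xor (isZero i ∧ isZero k)                    ∎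
  where open ≡-Reasoning

GLam-diagonal : ∀ m (i : Fin (3 + m)) → GLam (3 + m) i i ≡ isZero i
GLam-diagonal zero    i       = from-yes (all? (λ i → GLam 3 i i ≟ᵇ isZero i)) i
GLam-diagonal (suc m) zero    = refl
GLam-diagonal (suc m) (suc i) = begin
  GLam (4 + m) (suc i) (suc i)                ≡⟨ GLam-attach (suc m) (suc i) (suc i) ⟩
  GLam (3 + m) i i xor (isZero i ∧ isZero i)  ≡⟨ cong (λ d → d xor (isZero i ∧ isZero i)) (GLam-diagonal m i) ⟩
  isZero i xor (isZero i ∧ isZero i)          ≡⟨ truthTable 1 {λ z → z xor (z ∧ z)} {λ _ → false} tt (isZero i) ⟩
  false                                       ∎
  where open ≡-Reasoning

GLam-loop⇒zero : ∀ m {v : Fin (3 + m)} → GLam (3 + m) v v ≡ true → v ≡ zero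
GLam-loop⇒zero m {zero}  _    = refl
GLam-loop⇒zero m {suc v} loop with trans (sym (GLam-diagonal m (suc v))) loop
... | ()

GLam-symmetric : ∀ n → SymmetricAdj (GLam n)
GLam-symmetric n x y = begin
  GLam n x y                ≡⟨ GLam≡glam n x y ⟩
  glam n (toℕ x) (toℕ y)    ≡⟨ ∨-swap (suc b ≡ᵇ suc (suc a)) (suc a ≡ᵇ suc (suc b)) ((suc a ≡ᵇ n ∸ 2) ∧ (suc b ≡ᵇ n))
                                   ((suc b ≡ᵇ n ∸ 2) ∧ (suc a ≡ᵇ n)) (a ≡ᵇ 0) (b ≡ᵇ 0) ⟩
  glam n (toℕ y) (toℕ x)    ≡⟨ sym (GLam≡glam n y x) ⟩
  GLam n y x                ∎
  where
  open ≡-Reasoning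
  a = toℕ x
  b = toℕ y
  ∨-swap : ∀ p₁ p₂ p₃ p₄ z₁ z₂ → p₁ ∨ p₂ ∨ p₃ ∨ p₄ ∨ (z₁ ∧ z₂) ≡ p₂ ∨ p₁ ∨ p₄ ∨ p₃ ∨ (z₂ ∧ z₁)
  ∨-swap = truthTable 6 tt

GLam-reduces : ∀ m → press (GLam (3 + m)) zero ≋ addIsolated (GLam⁻ m)
GLam-reduces m = ≋-trans (press-cong zero (GLam-attach m)) (press-attach (GLam⁻ m) {topRow m} (topRow-zero m))

Yields : ∀ {n} → Adj n → List (Fin n) → (Fin n → Fin n → Set) → Set
Yields A σ R = (∀ x → x ∈ σ) × InstrIs A σ R

Diagonal : ∀ {n} → Adj n → Set
Diagonal A = ∀ x y → A x y ≡ true → x ≡ y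

press-diagonal : ∀ {n} {A : Adj n} v → Diagonal A → Diagonal (press A v)
press-diagonal {A = A} v diag x y e with A x y in exy | A v x in evx | A v y in evy
... | true  | _     | _     = diag x y exy
... | false | true  | true  = trans (sym (diag v x evx)) (diag v y evy)
... | false | true  | false with () ← e
... | false | false | _     with () ← e

Path-diagonal : ∀ {n} {A : Adj n} {σ x y} → Diagonal A → Path A σ x y → x ≡ y
Path-diagonal diag ε = refl
Path-diagonal {x = x} diag (first {y = y} a _ ◅ p) = trans (diag x y a) (Path-diagonal diag p)
Path-diagonal {A = A} diag (later {v = v} a ◅ p) = trans (Path-diagonal (press-diagonal v diag) (a ◅ ε)) (Path-diagonal diag p)

TwoOrders : List (Fin 2) → Set
TwoOrders τ = τ ≡ zero ∷ suc zero ∷ [] ⊎ τ ≡ suc zero ∷ zero ∷ []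

loops2-Successful⇒ : ∀ {τ} → Successful loops2 τ → TwoOrders τ
loops2-Successful⇒ (done empty) with () ← empty zero zero
loops2-Successful⇒ (step {v = zero} _ (done empty)) with () ← empty (suc zero) (suc zero)
loops2-Successful⇒ (step {v = zero} _ (step {v = zero} () _))
loops2-Successful⇒ (step {v = zero} _ (step {v = suc zero} _ (done _))) = inj₁ refl
loops2-Successful⇒ (step {v = zero} _ (step {v = suc zero} _ (step {v = zero} () _)))
loops2-Successful⇒ (step {v = zero} _ (step {v = suc zero} _ (step {v = suc zero} () _)))
loops2-Successful⇒ (step {v = suc zero} _ (done empty)) with () ← empty zero zero
loops2-Successful⇒ (step {v = suc zero} _ (step {v = suc zero} () _))
loops2-Successful⇒ (step {v = suc zero} _ (step {v = zero} _ (done _))) = inj₂ refl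
loops2-Successful⇒ (step {v = suc zero} _ (step {v = zero} _ (step {v = zero} () _)))
loops2-Successful⇒ (step {v = suc zero} _ (step {v = zero} _ (step {v = suc zero} () _)))

loops2-Successful⇐ : ∀ {τ} → TwoOrders τ → Successful loops2 τ
loops2-Successful⇐ (inj₁ refl) = step refl (step refl (done (from-yes (press (press loops2 zero) (suc zero) ≋? λ _ _ → false))))
loops2-Successful⇐ (inj₂ refl) = step refl (step refl (done (from-yes (press (press loops2 (suc zero)) zero ≋? λ _ _ → false))))

TwoOrders-covers : ∀ {τ} → TwoOrders τ → ∀ x → x ∈ τ
TwoOrders-covers (inj₁ refl) zero       = here refl
TwoOrders-covers (inj₁ refl) (suc zero) = there (here refl)
TwoOrders-covers (inj₂ refl) zero       = there (here refl)
TwoOrders-covers (inj₂ refl) (suc zero) = here refl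

Unique-covering⇒TwoOrders : ∀ {τ} → Unique τ → (∀ x → x ∈ τ) → TwoOrders τ
Unique-covering⇒TwoOrders {[]} _ covers with () ← covers zero
Unique-covering⇒TwoOrders {zero ∷ []} _ covers with covers (suc zero)
... | here ()
... | there ()
Unique-covering⇒TwoOrders {suc zero ∷ []} _ covers with covers zero
... | here ()
... | there ()
Unique-covering⇒TwoOrders {zero ∷ suc zero ∷ []} _ _ = inj₁ refl
Unique-covering⇒TwoOrders {suc zero ∷ zero ∷ []} _ _ = inj₂ refl
Unique-covering⇒TwoOrders {zero ∷ zero ∷ _} ((z≢z ∷ _) ∷ _) _ = ⊥-elim (z≢z refl)
Unique-covering⇒TwoOrders {suc zero ∷ suc zero ∷ _} ((o≢o ∷ _) ∷ _) _ = ⊥-elim (o≢o refl)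
Unique-covering⇒TwoOrders {zero ∷ suc zero ∷ zero ∷ _} ((_ ∷ z≢z ∷ _) ∷ _) _ = ⊥-elim (z≢z refl)
Unique-covering⇒TwoOrders {zero ∷ suc zero ∷ suc zero ∷ _} (_ ∷ (o≢o ∷ _) ∷ _) _ = ⊥-elim (o≢o refl)
Unique-covering⇒TwoOrders {suc zero ∷ zero ∷ zero ∷ _} (_ ∷ (z≢z ∷ _) ∷ _) _ = ⊥-elim (z≢z refl)
Unique-covering⇒TwoOrders {suc zero ∷ zero ∷ suc zero ∷ _} ((_ ∷ o≢o ∷ _) ∷ _) _ = ⊥-elim (o≢o refl)

loops2-yields : ∀ {τ} → Successful loops2 τ → Yields loops2 τ (Lam 2)
loops2-yields s = TwoOrders-covers (loops2-Successful⇒ s) , λ x y →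
  mk⇔ (λ p → subst (λ z → Lam 2 y z) (sym (Path-diagonal diag p)) ε)
      (λ l → subst (λ z → Path loops2 _ z y) (sym (Lam2-discrete l)) ε)
  where
  diag : Diagonal loops2
  diag zero       zero       _ = refl
  diag (suc zero) (suc zero) _ = refl
  diag zero       (suc _)    ()
  diag (suc _)    zero       ()

Successful-onlyLoop : ∀ {n} {A : Adj (suc n)} {σ} → A zero zero ≡ true → (∀ {v} → A v v ≡ true → v ≡ zero) →
  Successful A σ → ∃[ vs ] (σ ≡ zero ∷ vs)
Successful-onlyLoop loop₀ only (done empty) with () ← trans (sym loop₀) (empty zero zero)
Successful-onlyLoop loop₀ only (step loop _) with only loop
... | refl = _ , refl

GLam-Successful-uncons : ∀ m {σ} → Successful (GLam (3 + m)) σ →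
  ∃[ τ ] (σ ≡ zero ∷ map suc τ × Successful (GLam⁻ m) τ)
GLam-Successful-uncons m s with Successful-onlyLoop (GLam-diagonal m zero) (GLam-loop⇒zero m) s
... | vs , refl with FirstPressed.Successful-uncons (GLam-reduces m) s
...   | τ , refl , t = τ , refl , t

GLam-reaches-all : ∀ m {τ} → Yields (GLam⁻ m) τ (Lam (2 + m)) → ∀ b → Path (GLam (3 + m)) (zero ∷ map suc τ) zero (suc b)
GLam-reaches-all zero    (covers , _) b = Path-from-zero (GLam-reduces 0) covers (edge b) ε
  where
  edge : ∀ b → GLam 3 zero (suc b) ≡ true
  edge zero       = refl
  edge (suc zero) = refl
GLam-reaches-all (suc m) (covers , instr) b =
  Path-from-zero (GLam-reduces (suc m)) covers refl (Equivalence.from (instr zero b) (Lam-zero-greatest m b))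

GLam⁻-yields : ∀ m {τ} → Successful (GLam⁻ m) τ → Yields (GLam⁻ m) τ (Lam (2 + m))
GLam-yields  : ∀ m {σ} → Successful (GLam (3 + m)) σ → Yields (GLam (3 + m)) σ (Lam (3 + m))
GLam⁻-yields zero    = loops2-yields
GLam⁻-yields (suc m) = GLam-yields m
GLam-yields m s with GLam-Successful-uncons m s
... | τ , refl , t = InstrIs-Lam-covers isLam , isLam
  where
  isLam : InstrIs (GLam (3 + m)) (zero ∷ map suc τ) (Lam (3 + m))
  isLam = InstrIs-cons (GLam-reduces m) (proj₂ (GLam⁻-yields m t)) (GLam-reaches-all m (GLam⁻-yields m t))

GLam⁻-successful : ∀ m → ∃[ τ ] Successful (GLam⁻ m) τ
GLam-successful  : ∀ m → ∃[ σ ] Successful (GLam (3 + m)) σ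
GLam⁻-successful zero    = _ , loops2-Successful⇐ (inj₁ refl)
GLam⁻-successful (suc m) = GLam-successful m
GLam-successful m with GLam⁻-successful m
... | τ , t = zero ∷ map suc τ , FirstPressed.Successful-cons (GLam-reduces m) (GLam-diagonal m zero) t

avoids-zero⇒map-suc : ∀ {k} (vs : List (Fin (suc k))) → All (zero ≢_) vs → ∃[ ws ] (vs ≡ map suc ws)
avoids-zero⇒map-suc [] _ = [] , refl
avoids-zero⇒map-suc (zero ∷ vs) (z≢z ∷ _) = ⊥-elim (z≢z refl)
avoids-zero⇒map-suc (suc w ∷ vs) (_ ∷ avoid) with avoids-zero⇒map-suc vs avoid
... | ws , refl = w ∷ ws , refl

GLam⁻-linExt : ∀ m τ → Unique τ → (∀ x → x ∈ τ) → Ordered (Lam (2 + m)) τ → Successful (GLam⁻ m) τ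
GLam-linExt  : ∀ m σ → Unique σ → (∀ x → x ∈ σ) → Ordered (Lam (3 + m)) σ → Successful (GLam (3 + m)) σ
GLam⁻-linExt zero    τ u covers _ = loops2-Successful⇐ (Unique-covering⇒TwoOrders u covers)
GLam⁻-linExt (suc m) = GLam-linExt m
GLam-linExt m [] _ covers _ with () ← covers zero
GLam-linExt m (v ∷ vs) (v∉ ∷ u) covers (v-max ∷ o) with v≡zero
  where
  v≡zero : v ≡ zero
  v≡zero with covers zero
  ... | here z≡v = sym z≡v
  ... | there z∈ = All-lookup v-max z∈ (Lam-zero-greatest m v)
... | refl with avoids-zero⇒map-suc vs v∉
...   | ws , refl = FirstPressed.Successful-cons (GLam-reduces m) (GLam-diagonal m zero)
          (GLam⁻-linExt m ws (Unique-map⁻ u) (λ x → suc∈map-suc (tail∈ (covers (suc x))))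
            (AllPairs.map (λ below l → suc-injective (below (Equivalence.from (Lam-shift⇔ m) l))) (AllPairs-map⁻ o)))
  where
  tail∈ : ∀ {x} → Fin.suc x ∈ zero ∷ map Fin.suc ws → Fin.suc x ∈ map Fin.suc ws
  tail∈ (here ())
  tail∈ (there x∈) = x∈

-- Full rank

sumF2-cong : ∀ {n} {f g : Fin n → Bool} → (∀ k → f k ≡ g k) → sumF2 f ≡ sumF2 g
sumF2-cong {zero}  e = refl
sumF2-cong {suc n} e = cong₂ _xor_ (e zero) (sumF2-cong (λ k → e (suc k)))

sumF2-false : ∀ {n} → sumF2 {n} (λ _ → false) ≡ false
sumF2-false {zero}  = refl
sumF2-false {suc n} = sumF2-false {n}

sumF2-xor : ∀ {n} (f g : Fin n → Bool) → sumF2 (λ k → f k xor g k) ≡ sumF2 f xor sumF2 g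
sumF2-xor {zero}  f g = refl
sumF2-xor {suc n} f g rewrite sumF2-xor (λ k → f (suc k)) (λ k → g (suc k)) = xor-interchange (f zero) (g zero) _ _
  where
  xor-interchange : ∀ a b c d → (a xor b) xor (c xor d) ≡ (a xor c) xor (b xor d)
  xor-interchange = truthTable 4 tt

sumF2-∧ˡ : ∀ {n} c (f : Fin n → Bool) → sumF2 (λ k → c ∧ f k) ≡ c ∧ sumF2 f
sumF2-∧ˡ     true  f = refl
sumF2-∧ˡ {n} false f = sumF2-false {n}

sumF2-isZero : ∀ {n} (f : Fin (suc n) → Bool) → sumF2 (λ k → isZero k ∧ f k) ≡ f zero
sumF2-isZero {n} f = trans (cong (f zero xor_) (sumF2-false {n})) (xor-identityʳ (f zero))

sumF2-isZeroʳ : ∀ {n} (g : Fin (suc n) → Bool) c → sumF2 (λ k → g k ∧ (isZero k ∧ c)) ≡ g zero ∧ c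
sumF2-isZeroʳ {n} g c = trans (cong ((g zero ∧ c) xor_) vanish) (xor-identityʳ (g zero ∧ c))
  where
  vanish : sumF2 (λ k → g (suc k) ∧ false) ≡ false
  vanish = trans (sumF2-cong (λ k → ∧-zeroʳ (g (suc k)))) (sumF2-false {n})

xor-cancel : ∀ a b → a xor (b xor a) ≡ b
xor-cancel = truthTable 2 tt

idMat-suc : ∀ {n} (i j : Fin n) → idMat (suc i) (suc j) ≡ idMat i j
idMat-suc i j = trans (⌊≟⌋≡ᵇ (suc (toℕ i)) (suc (toℕ j))) (sym (⌊≟⌋≡ᵇ (toℕ i) (toℕ j)))

idMat-zeroʳ : ∀ {n} (i : Fin (suc n)) → idMat i zero ≡ isZero i
idMat-zeroʳ zero    = refl
idMat-zeroʳ (suc i) = refl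

idMat-zeroˡ : ∀ {n} (j : Fin (suc n)) → idMat zero j ≡ isZero j
idMat-zeroˡ zero    = refl
idMat-zeroˡ (suc j) = refl

InverseOf : ∀ {n} → Adj n → Adj n → Set
InverseOf A C = (∀ i j → matMul A C i j ≡ idMat i j) × (∀ i j → matMul C A i j ≡ idMat i j)

InverseOf-resp : ∀ {n} {A A′ C : Adj n} → A ≋ A′ → InverseOf A C → InverseOf A′ C
InverseOf-resp {C = C} e (AC , CA) =
  (λ i j → trans (sumF2-cong (λ k → cong (_∧ C k j) (sym (e i k)))) (AC i j)) ,
  (λ i j → trans (sumF2-cong (λ k → cong (C i k ∧_) (sym (e k j)))) (CA i j))

extendInverse : ∀ {n} → Adj (suc n) → Adj (suc (suc n))
extendInverse C zero    zero    = not (C zero zero)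
extendInverse C zero    (suc j) = C zero j
extendInverse C (suc i) zero    = C i zero
extendInverse C (suc i) (suc j) = C i j

module _ {n} (B C : Adj (suc n)) where

  private
    A = attach B upToOne

  row-split : ∀ i z (g : Fin (suc n) → Bool) →
    sumF2 (λ k → (B i k xor (z ∧ isZero k)) ∧ g k) ≡ sumF2 (λ k → B i k ∧ g k) xor (z ∧ g zero)
  row-split i z g = begin
    sumF2 (λ k → (B i k xor (z ∧ isZero k)) ∧ g k)             ≡⟨ sumF2-cong (λ k → distrib (B i k) z (isZero k) (g k)) ⟩
    sumF2 (λ k → (B i k ∧ g k) xor (z ∧ (isZero k ∧ g k)))      ≡⟨ sumF2-xor (λ k → B i k ∧ g k) (λ k → z ∧ (isZero k ∧ g k)) ⟩
    sumF2 (λ k → B i k ∧ g k) xor sumF2 (λ k → z ∧ (isZero k ∧ g k))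
                                                                ≡⟨ cong (sumF2 (λ k → B i k ∧ g k) xor_) (trans (sumF2-∧ˡ z (λ k → isZero k ∧ g k)) (cong (z ∧_) (sumF2-isZero g))) ⟩
    sumF2 (λ k → B i k ∧ g k) xor (z ∧ g zero)                  ∎
    where
    open ≡-Reasoning
    distrib : ∀ b z e g → (b xor (z ∧ e)) ∧ g ≡ (b ∧ g) xor (z ∧ (e ∧ g))
    distrib = truthTable 4 tt

  col-split : ∀ j z (g : Fin (suc n) → Bool) →
    sumF2 (λ k → g k ∧ (B k j xor (isZero k ∧ z))) ≡ sumF2 (λ k → g k ∧ B k j) xor (g zero ∧ z)
  col-split j z g = begin
    sumF2 (λ k → g k ∧ (B k j xor (isZero k ∧ z)))             ≡⟨ sumF2-cong (λ k → distrib (g k) (B k j) (isZero k) z) ⟩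
    sumF2 (λ k → (g k ∧ B k j) xor (isZero k ∧ (g k ∧ z)))      ≡⟨ sumF2-xor (λ k → g k ∧ B k j) (λ k → isZero k ∧ (g k ∧ z)) ⟩
    sumF2 (λ k → g k ∧ B k j) xor sumF2 (λ k → isZero k ∧ (g k ∧ z))
                                                                ≡⟨ cong (sumF2 (λ k → g k ∧ B k j) xor_) (sumF2-isZero (λ k → g k ∧ z)) ⟩
    sumF2 (λ k → g k ∧ B k j) xor (g zero ∧ z)                  ∎
    where
    open ≡-Reasoning
    distrib : ∀ g b e z → g ∧ (b xor (e ∧ z)) ≡ (g ∧ b) xor (e ∧ (g ∧ z))
    distrib = truthTable 4 tt

  attach-inverse : InverseOf B C → InverseOf A (extendInverse C)
  attach-inverse (BC , CB) = AC , CA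
    where
    AC : ∀ i j → matMul A (extendInverse C) i j ≡ idMat i j
    AC zero    zero    = trans (cong (not (C zero zero) xor_) (sumF2-isZero (λ k → C k zero))) (truthTable 1 {λ c → not c xor c} {λ _ → true} tt (C zero zero))
    AC zero    (suc j) = trans (cong (C zero j xor_) (sumF2-isZero (λ k → C k j))) (xor-same (C zero j))
    AC (suc i) zero = begin
      ((isZero i ∧ true) ∧ not c) xor sumF2 (λ k → (B i k xor (isZero i ∧ isZero k)) ∧ C k zero)
        ≡⟨ cong (((isZero i ∧ true) ∧ not c) xor_) (row-split i (isZero i) (λ k → C k zero)) ⟩
      ((isZero i ∧ true) ∧ not c) xor (matMul B C i zero xor (isZero i ∧ c))
        ≡⟨ cong (λ d → ((isZero i ∧ true) ∧ not c) xor (d xor (isZero i ∧ c))) (trans (BC i zero) (idMat-zeroʳ i)) ⟩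
      ((isZero i ∧ true) ∧ not c) xor (isZero i xor (isZero i ∧ c))
        ≡⟨ truthTable 2 {λ z c → ((z ∧ true) ∧ not c) xor (z xor (z ∧ c))} {λ _ _ → false} tt (isZero i) c ⟩
      false ∎
      where
      open ≡-Reasoning
      c = C zero zero
    AC (suc i) (suc j) = begin
      ((isZero i ∧ true) ∧ C zero j) xor sumF2 (λ k → (B i k xor (isZero i ∧ isZero k)) ∧ C k j)
        ≡⟨ cong₂ (λ t s → (t ∧ C zero j) xor s) (∧-identityʳ (isZero i)) (row-split i (isZero i) (λ k → C k j)) ⟩
      (isZero i ∧ C zero j) xor (matMul B C i j xor (isZero i ∧ C zero j))
        ≡⟨ xor-cancel (isZero i ∧ C zero j) (matMul B C i j) ⟩
      matMul B C i j
        ≡⟨ trans (BC i j) (sym (idMat-suc i j)) ⟩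
      idMat (suc i) (suc j) ∎
      where open ≡-Reasoning
    CA : ∀ i j → matMul (extendInverse C) A i j ≡ idMat i j
    CA zero zero = begin
      (not c ∧ true) xor sumF2 (λ k → C zero k ∧ (isZero k ∧ true))
        ≡⟨ cong ((not c ∧ true) xor_) (sumF2-isZeroʳ (C zero) true) ⟩
      (not c ∧ true) xor (c ∧ true)
        ≡⟨ truthTable 1 {λ c → (not c ∧ true) xor (c ∧ true)} {λ _ → true} tt c ⟩
      true ∎
      where
      open ≡-Reasoning
      c = C zero zero
    CA zero (suc j) = begin
      (not c ∧ isZero j) xor sumF2 (λ k → C zero k ∧ (B k j xor (isZero k ∧ isZero j)))
        ≡⟨ cong ((not c ∧ isZero j) xor_) (col-split j (isZero j) (C zero)) ⟩
      (not c ∧ isZero j) xor (matMul C B zero j xor (c ∧ isZero j))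
        ≡⟨ cong (λ d → (not c ∧ isZero j) xor (d xor (c ∧ isZero j))) (trans (CB zero j) (idMat-zeroˡ j)) ⟩
      (not c ∧ isZero j) xor (isZero j xor (c ∧ isZero j))
        ≡⟨ truthTable 2 {λ c z → (not c ∧ z) xor (z xor (c ∧ z))} {λ _ _ → false} tt c (isZero j) ⟩
      false ∎
      where
      open ≡-Reasoning
      c = C zero zero
    CA (suc i) zero = trans (cong ((C i zero ∧ true) xor_) (sumF2-isZeroʳ (C i) true)) (xor-same (C i zero ∧ true))
    CA (suc i) (suc j) = begin
      (C i zero ∧ isZero j) xor sumF2 (λ k → C i k ∧ (B k j xor (isZero k ∧ isZero j)))
        ≡⟨ cong ((C i zero ∧ isZero j) xor_) (col-split j (isZero j) (C i)) ⟩
      (C i zero ∧ isZero j) xor (matMul C B i j xor (C i zero ∧ isZero j))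
        ≡⟨ xor-cancel (C i zero ∧ isZero j) (matMul C B i j) ⟩
      matMul C B i j
        ≡⟨ trans (CB i j) (sym (idMat-suc i j)) ⟩
      idMat (suc i) (suc j) ∎
      where open ≡-Reasoning

GLam3⁻¹ : Adj 3
GLam3⁻¹ (suc zero) (suc (suc zero)) = false
GLam3⁻¹ (suc (suc zero)) (suc zero) = false
GLam3⁻¹ _ _ = true

GLam-inverse : ∀ m → Σ (Adj (3 + m)) (InverseOf (GLam (3 + m)))
GLam-inverse zero = GLam3⁻¹ , from-yes (matMul (GLam 3) GLam3⁻¹ ≋? idMat) , from-yes (matMul GLam3⁻¹ (GLam 3) ≋? idMat)
GLam-inverse (suc m) with GLam-inverse m
... | C , inv = extendInverse C , InverseOf-resp {C = extendInverse C} (≋-sym (GLam-attach (suc m))) (attach-inverse (GLam (3 + m)) C inv)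

GLam-SfrakIsLam : ∀ m → SfrakIsLam (3 + m) (GLam (3 + m))
GLam-SfrakIsLam m = GLam-successful m , λ σ s x y → ⇔-trans instr⇔Path (proj₂ (GLam-yields m s) x y)

Lam-autonomous : ∀ m → Autonomous (Lam (3 + m))
Lam-autonomous m = 3 + m , GLam (3 + m) , σ₀ , GLam-symmetric (3 + m) , GLam-inverse m , s₀ ,
                   (↔-id (Fin (3 + m)) , isLam) , λ τ → mk⇔ (linExt τ) (successful τ)
  where
  σ₀ = proj₁ (GLam-successful m)
  s₀ = proj₂ (GLam-successful m)
  isLam : ∀ x y → instr (GLam (3 + m)) σ₀ y x ⇔ Lam (3 + m) y x
  isLam = proj₂ (GLam-SfrakIsLam m) σ₀ s₀
  linExt : ∀ τ → Successful (GLam (3 + m)) τ → LinExt (instr (GLam (3 + m)) σ₀) τ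
  linExt τ s = Successful⇒Unique (GLam-symmetric _) s , proj₁ (GLam-yields m s) ,
    Ordered⇒IndexOrdered τ (Ordered-mono τ (λ {a} {b} _ _ p → Equivalence.from (proj₂ (GLam-yields m s) b a) (Equivalence.to (isLam b a) p))
                                          (Successful⇒Ordered (GLam-symmetric _) s))
  successful : ∀ τ → LinExt (instr (GLam (3 + m)) σ₀) τ → Successful (GLam (3 + m)) τ
  successful τ (u , covers , ordered) =
    GLam-linExt m τ u covers (Ordered-mono τ (λ {a} {b} _ _ l → Equivalence.from (isLam b a) l) (IndexOrdered⇒Ordered τ ordered))

-- Triangular Gram decompositions over F₂

Row : Set
Row = ℕ → Bool

_⊕_ : Row → Row → Row
(f ⊕ g) x = f x xor g x

gram : List (ℕ × Row) → ℕ → ℕ → Bool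
gram []            a b = false
gram ((_ , w) ∷ L) a b = (w a ∧ w b) xor gram L a b

Vanishes : ℕ → ℕ × Row → Set
Vanishes x e = proj₂ e x ≡ false

-- Entries are (pivot , row): each row is 1 at its pivot, and every later row is 0 there.
Triangular : List (ℕ × Row) → Set
Triangular L = All (λ e → proj₂ e (proj₁ e) ≡ true) L × AllPairs (λ e → Vanishes (proj₁ e)) L

clamp : ∀ N → ℕ → Fin (suc N)
clamp N       zero    = zero
clamp zero    (suc p) = zero
clamp (suc N) (suc p) = suc (clamp N p)

toℕ-clamp : ∀ N {p} → p ≤ N → toℕ (clamp N p) ≡ p
toℕ-clamp N       {zero}  _         = refl
toℕ-clamp (suc N) {suc p} (s≤s p≤N) = cong suc (toℕ-clamp N p≤N)

clamp-toℕ : ∀ N (x : Fin (suc N)) → clamp N (toℕ x) ≡ x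
clamp-toℕ N       zero    = refl
clamp-toℕ (suc N) (suc x) = cong suc (clamp-toℕ N x)

HasGram : ∀ {N} → Adj (suc N) → List (ℕ × Row) → Set
HasGram A L = ∀ x y → A x y ≡ gram L (toℕ x) (toℕ y)

gram-vanishes : ∀ {x} L → All (Vanishes x) L → ∀ b → gram L x b ≡ false
gram-vanishes [] [] b = refl
gram-vanishes ((_ , w) ∷ L) (wx ∷ vanish) b rewrite wx = gram-vanishes L vanish b

-- Pressing the pivots in order is the elimination that produced the decomposition.
triangular⇒successful : ∀ {N} {A : Adj (suc N)} L → Triangular L → All (λ e → proj₁ e ≤ N) L → HasGram A L →
  Successful A (map (clamp N ∘ proj₁) L)
triangular⇒successful [] _ _ A≋ = done A≋
triangular⇒successful {N} {A} ((p , w) ∷ L) (wp ∷ pivots , clear ∷ clears) (p≤N ∷ bounded) A≋ =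
  step loop (triangular⇒successful L (pivots , clears) bounded pressed≋)
  where
  v = clamp N p
  row : ∀ x → A v x ≡ w (toℕ x)
  row x rewrite A≋ v x | toℕ-clamp N p≤N | wp | gram-vanishes L clear (toℕ x) = xor-identityʳ (w (toℕ x))
  loop : A v v ≡ true
  loop = trans (row v) (trans (cong w (toℕ-clamp N p≤N)) wp)
  pressed≋ : HasGram (press A v) L
  pressed≋ x y rewrite row x | row y | A≋ x y = truthTable 3 {λ a b g → ((a ∧ b) xor g) xor (a ∧ b)} {λ _ _ g → g} tt (w (toℕ x)) (w (toℕ y)) _

atMost : ℕ → ℕ → Bool
atMost zero    _       = true
atMost (suc _) zero    = false
atMost (suc a) (suc b) = atMost a b

-- Row i of the factor U of G_Λ(k+3) = UᵀU, i.e. of I + (Hasse diagram of Λ(k+3)), with 0-based labels: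
-- e_i + e_{i+1} for i ≤ k, plus e_{k+2} for i = k.
hasseRow : ℕ → ℕ → Row
hasseRow k i x = (x ≡ᵇ i) ∨ (((x ≡ᵇ suc (suc k)) ∧ (i ≡ᵇ k)) ∨ ((x ≡ᵇ suc i) ∧ atMost i k))

hasseRows : ℕ → ℕ → ℕ → List (ℕ × Row)
hasseRows k a zero    = []
hasseRows k a (suc c) = (a , hasseRow k a) ∷ hasseRows k (suc a) c

≡ᵇ-true : ∀ {a b} → a ≡ b → (a ≡ᵇ b) ≡ true
≡ᵇ-true {a} {b} = dec-true (a ≟ℕ b)

≡ᵇ-false : ∀ {a b} → a ≢ b → (a ≡ᵇ b) ≡ false
≡ᵇ-false {a} {b} = dec-false (a ≟ℕ b)

atMost-true : ∀ {a b} → a ≤ b → atMost a b ≡ true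
atMost-true z≤n       = refl
atMost-true (s≤s a≤b) = atMost-true a≤b

atMost-false : ∀ {a b} → b < a → atMost a b ≡ false
atMost-false {suc a} {zero}  _         = refl
atMost-false {suc a} {suc b} (s≤s b<a) = atMost-false b<a

hasse-self : ∀ k i → hasseRow k i i ≡ true
hasse-self k i rewrite ≡ᵇ-true (refl {x = i}) = refl

hasse-below : ∀ k {i x} → x < i → hasseRow k i x ≡ false
hasse-below k {i} {x} x<i rewrite ≡ᵇ-false (<⇒≢ x<i) | ≡ᵇ-false (<⇒≢ (≤-trans x<i (n≤1+n i))) with i ≟ℕ k
... | yes refl rewrite ≡ᵇ-false (<⇒≢ (≤-trans x<i (≤-trans (n≤1+n i) (n≤1+n (suc i))))) = refl
... | no i≢k rewrite ≡ᵇ-false i≢k | ∧-zeroʳ (x ≡ᵇ suc (suc k)) = refl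

hasse-next : ∀ k {i} → i ≤ k → hasseRow k i (suc i) ≡ true
hasse-next k {i} i≤k rewrite ≡ᵇ-false (>⇒≢ (≤-refl {suc i})) | ≡ᵇ-true (refl {x = i}) | atMost-true i≤k = ∨-zeroʳ _

hasse-far : ∀ k {i x} → i < k → suc (suc i) ≤ x → hasseRow k i x ≡ false
hasse-far k {i} {x} i<k i+2≤x
  rewrite ≡ᵇ-false (>⇒≢ (≤-trans (n≤1+n (suc i)) i+2≤x)) | ≡ᵇ-false (<⇒≢ i<k)
        | ≡ᵇ-false (>⇒≢ i+2≤x) | ∧-zeroʳ (x ≡ᵇ suc (suc k)) = refl

hasse-fork : ∀ k → hasseRow k k (suc (suc k)) ≡ true
hasse-fork k rewrite ≡ᵇ-false (>⇒≢ (n≤1+n (suc k))) | ≡ᵇ-true (refl {x = k}) = refl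

hasse-fork-next : ∀ k → hasseRow k (suc k) (suc (suc k)) ≡ false
hasse-fork-next k rewrite ≡ᵇ-false (>⇒≢ (≤-refl {suc k})) | ≡ᵇ-true (refl {x = k}) | atMost-false (≤-refl {suc k}) = refl

hasse-zero : ∀ k x → hasseRow (suc k) 0 (suc x) ≡ (x ≡ᵇ 0)
hasse-zero k x rewrite ∧-zeroʳ (x ≡ᵇ suc (suc k)) | ∧-identityʳ (x ≡ᵇ 0) = refl

gram-hasse-shift : ∀ k a c x y → gram (hasseRows (suc k) (suc a) c) (suc x) (suc y) ≡ gram (hasseRows k a c) x y
gram-hasse-shift k a zero    x y = refl
gram-hasse-shift k a (suc c) x y = cong ((hasseRow k a x ∧ hasseRow k a y) xor_) (gram-hasse-shift k (suc a) c x y)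

gram-hasse-zeroˡ : ∀ k a c y → gram (hasseRows (suc k) (suc a) c) 0 y ≡ false
gram-hasse-zeroˡ k a zero    y = refl
gram-hasse-zeroˡ k a (suc c) y = gram-hasse-zeroˡ k (suc a) c y

gram-hasse-zeroʳ : ∀ k a c x → gram (hasseRows (suc k) (suc a) c) x 0 ≡ false
gram-hasse-zeroʳ k a zero    x = refl
gram-hasse-zeroʳ k a (suc c) x rewrite ∧-zeroʳ (hasseRow (suc k) (suc a) x) = gram-hasse-zeroʳ k (suc a) c x

HasGram-resp : ∀ {N} {A A′ : Adj (suc N)} {L} → A ≋ A′ → HasGram A L → HasGram A′ L
HasGram-resp e A≋ x y = trans (sym (e x y)) (A≋ x y)

HasGram-attach : ∀ {N} {B : Adj N} {r : Fin (suc N) → Bool} {r′ : Row} {L} →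
  HasGram (addIsolated B) L → (∀ x → r′ (toℕ x) ≡ r x) → HasGram (attach B r) ((0 , r′) ∷ L)
HasGram-attach {B = B} {r} {r′} {L} B≋ r≡ x y = begin
  addIsolated B x y xor (r x ∧ r y)                       ≡⟨ cong₂ (λ g t → g xor t) (B≋ x y) (sym (cong₂ _∧_ (r≡ x) (r≡ y))) ⟩
  gram L (toℕ x) (toℕ y) xor (r′ (toℕ x) ∧ r′ (toℕ y))   ≡⟨ xor-comm (gram L (toℕ x) (toℕ y)) (r′ (toℕ x) ∧ r′ (toℕ y)) ⟩
  (r′ (toℕ x) ∧ r′ (toℕ y)) xor gram L (toℕ x) (toℕ y)   ∎
  where open ≡-Reasoning

GLam-hasGram            : ∀ k → HasGram (GLam (3 + k)) (hasseRows k 0 (3 + k))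
addIsolated-GLam-hasGram : ∀ k → HasGram (addIsolated (GLam (3 + k))) (hasseRows (suc k) 1 (3 + k))
GLam-hasGram zero    = from-yes (GLam 3 ≋? λ x y → gram (hasseRows 0 0 3) (toℕ x) (toℕ y))
GLam-hasGram (suc k) =
  HasGram-resp {L = hasseRows (suc k) 0 (4 + k)} (≋-sym (GLam-attach (suc k)))
    (HasGram-attach {r′ = hasseRow (suc k) 0} {L = hasseRows (suc k) 1 (3 + k)} (addIsolated-GLam-hasGram k) topRow≡)
  where
  topRow≡ : ∀ x → hasseRow (suc k) 0 (toℕ x) ≡ upToOne x
  topRow≡ zero    = refl
  topRow≡ (suc x) = trans (hasse-zero k (toℕ x)) (sym (isZero≡ x))
addIsolated-GLam-hasGram k zero    y       = sym (gram-hasse-zeroˡ k 0 (3 + k) (toℕ y))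
addIsolated-GLam-hasGram k (suc x) zero    = sym (gram-hasse-zeroʳ k 0 (3 + k) (suc (toℕ x)))
addIsolated-GLam-hasGram k (suc x) (suc y) = trans (GLam-hasGram k x y) (sym (gram-hasse-shift k 0 (3 + k) (toℕ x) (toℕ y)))

gram-swap : ∀ {q q′ r r′ : ℕ} w w′ L a b → gram ((q , w) ∷ (q′ , w′) ∷ L) a b ≡ gram ((r , w′) ∷ (r′ , w) ∷ L) a b
gram-swap w w′ L a b = truthTable 3 {λ c d g → c xor (d xor g)} {λ c d g → d xor (c xor g)} tt (w a ∧ w b) (w′ a ∧ w′ b) (gram L a b)

gram-↭ : ∀ {L L′} → L ↭ L′ → ∀ a b → gram L a b ≡ gram L′ a b
gram-↭ ↭.refl a b = refl
gram-↭ (↭.prep (_ , w) p) a b = cong ((w a ∧ w b) xor_) (gram-↭ p a b)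
gram-↭ {(q , w) ∷ (q′ , w′) ∷ L} (↭.swap _ _ p) a b =
  trans (gram-swap {q} {q′} {q′} {q} w w′ L a b) (cong (λ g → (w′ a ∧ w′ b) xor ((w a ∧ w b) xor g)) (gram-↭ p a b))
gram-↭ (↭.trans p q) a b = trans (gram-↭ p a b) (gram-↭ q a b)

-- Over F₂ the 4×4 matrix J − I is orthogonal.
gram-exchange : ∀ {q₁ q₂ q₃ q₄ r₁ r₂ r₃ r₄ : ℕ} u x₁ x₂ x₃ L a b →
  gram ((q₁ , u ⊕ (x₁ ⊕ x₂)) ∷ (q₂ , u ⊕ (x₁ ⊕ x₃)) ∷ (q₃ , u ⊕ (x₂ ⊕ x₃)) ∷ (q₄ , x₁ ⊕ (x₂ ⊕ x₃)) ∷ L) a b ≡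
  gram ((r₁ , u) ∷ (r₂ , x₁) ∷ (r₃ , x₂) ∷ (r₄ , x₃) ∷ L) a b
gram-exchange u x₁ x₂ x₃ L a b = exchange (u a) (x₁ a) (x₂ a) (x₃ a) (u b) (x₁ b) (x₂ b) (x₃ b) (gram L a b)
  where
  exchange : ∀ u a b c u′ a′ b′ c′ g →
    ((u xor (a xor b)) ∧ (u′ xor (a′ xor b′))) xor (((u xor (a xor c)) ∧ (u′ xor (a′ xor c′))) xor
      (((u xor (b xor c)) ∧ (u′ xor (b′ xor c′))) xor (((a xor (b xor c)) ∧ (a′ xor (b′ xor c′))) xor g))) ≡
    (u ∧ u′) xor ((a ∧ a′) xor ((b ∧ b′) xor ((c ∧ c′) xor g)))
  exchange = truthTable 9 tt

-- Replacing u, x₁, x₂, x₃ by three rows with pivots y, z, 0 and x₁ + x₂ + x₃ with pivot p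
-- gives a decomposition whose elimination starts at y.
module Exchange {N} {A : Adj (suc N)} {u x₁ x₂ x₃ : Row} (L₁ L₂ : List (ℕ × Row)) {p y z : ℕ}
  (A≋ : HasGram A ((0 , u) ∷ (0 , x₁) ∷ (0 , x₂) ∷ (0 , x₃) ∷ L₁ ++ L₂))
  (triangular : Triangular (L₁ ++ (p , x₁ ⊕ (x₂ ⊕ x₃)) ∷ L₂))
  (bounded : All (λ e → proj₁ e ≤ N) (L₁ ++ (p , x₁ ⊕ (x₂ ⊕ x₃)) ∷ L₂)) (y≤N : y ≤ N) (z≤N : z ≤ N)
  (vanish : ∀ x → x ≡ 0 ⊎ x ≡ y ⊎ x ≡ z → All (Vanishes x) (L₁ ++ L₂))
  (u₀ : u 0 ≡ true) (x₁₀ : x₁ 0 ≡ false) (x₂₀ : x₂ 0 ≡ false) (x₃₀ : x₃ 0 ≡ false)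
  (uʸ : u y ≡ true) (x₁ʸ : x₁ y ≡ true) (x₂ʸ : x₂ y ≡ true) (x₃ʸ : x₃ y ≡ false)
  (x₂ᶻ : x₂ z ≡ not (x₁ z)) (x₃ᶻ : x₃ z ≡ true) where

  v t₁ t₂ t₃ : Row
  v  = x₁ ⊕ (x₂ ⊕ x₃)
  t₁ = u ⊕ (x₁ ⊕ x₂)
  t₂ = u ⊕ (x₁ ⊕ x₃)
  t₃ = u ⊕ (x₂ ⊕ x₃)

  rest-vanishes : ∀ x → x ≡ 0 ⊎ x ≡ y ⊎ x ≡ z → v x ≡ false → All (Vanishes x) (L₁ ++ (p , v) ∷ L₂)
  rest-vanishes x x∈ vx with All-++⁻ L₁ (vanish x x∈)
  ... | vanish₁ , vanish₂ = All-++⁺ vanish₁ (vx ∷ vanish₂)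

  v₀ : v 0 ≡ false
  v₀ rewrite x₁₀ | x₂₀ | x₃₀ = refl

  vʸ : v y ≡ false
  vʸ rewrite x₁ʸ | x₂ʸ | x₃ʸ = refl

  vᶻ : v z ≡ false
  vᶻ rewrite x₂ᶻ | x₃ᶻ = truthTable 1 {λ a → a xor (not a xor true)} {λ _ → false} tt (x₁ z)

  new-triangular : ∀ {s₂ s₃ : Row} → s₂ y ≡ false → s₃ y ≡ false → s₂ z ≡ true → s₃ z ≡ false → s₃ 0 ≡ true →
    Triangular ((y , t₁) ∷ (z , s₂) ∷ (0 , s₃) ∷ L₁ ++ (p , v) ∷ L₂)
  new-triangular s₂ʸ s₃ʸ s₂ᶻ s₃ᶻ s₃₀ =
    t₁ʸ ∷ s₂ᶻ ∷ s₃₀ ∷ proj₁ triangular ,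
    (s₂ʸ ∷ s₃ʸ ∷ rest-vanishes y (inj₂ (inj₁ refl)) vʸ) ∷ (s₃ᶻ ∷ rest-vanishes z (inj₂ (inj₂ refl)) vᶻ) ∷
    rest-vanishes 0 (inj₁ refl) v₀ ∷ proj₂ triangular
    where
    t₁ʸ : t₁ y ≡ true
    t₁ʸ rewrite uʸ | x₁ʸ | x₂ʸ = refl

  new-gram : ∀ {s₂ s₃} → (∀ a b → gram ((y , t₁) ∷ (z , s₂) ∷ (0 , s₃) ∷ (p , v) ∷ L₁ ++ L₂) a b ≡
                                   gram ((y , t₁) ∷ (z , t₂) ∷ (0 , t₃) ∷ (p , v) ∷ L₁ ++ L₂) a b) →
    HasGram A ((y , t₁) ∷ (z , s₂) ∷ (0 , s₃) ∷ L₁ ++ (p , v) ∷ L₂)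
  new-gram {s₂} {s₃} reorder a b = begin
    A a b                                                                  ≡⟨ A≋ a b ⟩
    gram ((0 , u) ∷ (0 , x₁) ∷ (0 , x₂) ∷ (0 , x₃) ∷ L₁ ++ L₂) a′ b′        ≡⟨ sym (gram-exchange {y} {z} {0} {p} {0} {0} {0} {0} u x₁ x₂ x₃ (L₁ ++ L₂) a′ b′) ⟩
    gram ((y , t₁) ∷ (z , t₂) ∷ (0 , t₃) ∷ (p , v) ∷ L₁ ++ L₂) a′ b′        ≡⟨ sym (reorder a′ b′) ⟩
    gram ((y , t₁) ∷ (z , s₂) ∷ (0 , s₃) ∷ (p , v) ∷ L₁ ++ L₂) a′ b′        ≡⟨ gram-↭ (↭.prep (y , t₁) (↭.prep (z , s₂) (↭.prep (0 , s₃) (↭-sym (shift (p , v) L₁ L₂))))) a′ b′ ⟩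
    gram ((y , t₁) ∷ (z , s₂) ∷ (0 , s₃) ∷ L₁ ++ (p , v) ∷ L₂) a′ b′        ∎
    where
    open ≡-Reasoning
    a′ = toℕ a
    b′ = toℕ b

  successful-from-y : ∃[ σ ] Successful A (clamp N y ∷ σ)
  successful-from-y with u z ≟ᵇ x₁ z
  ... | yes uᶻ = _ , triangular⇒successful _ (new-triangular t₂ʸ t₃ʸ t₂ᶻ t₃ᶻ t₃₀) (y≤N ∷ z≤N ∷ z≤n ∷ bounded) (new-gram {t₂} {t₃} λ _ _ → refl)
    where
    t₂ʸ : t₂ y ≡ false
    t₂ʸ rewrite uʸ | x₁ʸ | x₃ʸ = refl
    t₃ʸ : t₃ y ≡ false
    t₃ʸ rewrite uʸ | x₂ʸ | x₃ʸ = refl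
    t₂ᶻ : t₂ z ≡ true
    t₂ᶻ rewrite uᶻ | x₃ᶻ = truthTable 1 {λ a → a xor (a xor true)} {λ _ → true} tt (x₁ z)
    t₃ᶻ : t₃ z ≡ false
    t₃ᶻ rewrite uᶻ | x₂ᶻ | x₃ᶻ = truthTable 1 {λ a → a xor (not a xor true)} {λ _ → false} tt (x₁ z)
    t₃₀ : t₃ 0 ≡ true
    t₃₀ rewrite u₀ | x₂₀ | x₃₀ = refl
  ... | no uᶻ≢ = _ , triangular⇒successful _ (new-triangular t₃ʸ t₂ʸ t₃ᶻ t₂ᶻ t₂₀) (y≤N ∷ z≤N ∷ z≤n ∷ bounded)
                       (new-gram {t₃} {t₂} λ a b → cong ((t₁ a ∧ t₁ b) xor_) (gram-swap {z} {0} {z} {0} t₃ t₂ ((p , v) ∷ L₁ ++ L₂) a b))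
    where
    uᶻ : u z ≡ not (x₁ z)
    uᶻ = ¬-not uᶻ≢
    t₂ʸ : t₂ y ≡ false
    t₂ʸ rewrite uʸ | x₁ʸ | x₃ʸ = refl
    t₃ʸ : t₃ y ≡ false
    t₃ʸ rewrite uʸ | x₂ʸ | x₃ʸ = refl
    t₃ᶻ : t₃ z ≡ true
    t₃ᶻ rewrite uᶻ | x₂ᶻ | x₃ᶻ = truthTable 1 {λ a → not a xor (not a xor true)} {λ _ → true} tt (x₁ z)
    t₂ᶻ : t₂ z ≡ false
    t₂ᶻ rewrite uᶻ | x₃ᶻ = truthTable 1 {λ a → not a xor (a xor true)} {λ _ → false} tt (x₁ z)
    t₂₀ : t₂ 0 ≡ true
    t₂₀ rewrite u₀ | x₁₀ | x₃₀ = refl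

Triangular-++ : ∀ {X Y} → Triangular X → Triangular Y → All (λ e → All (Vanishes (proj₁ e)) Y) X → Triangular (X ++ Y)
Triangular-++ (pivotsˣ , clearˣ) (pivotsʸ , clearʸ) cross = All-++⁺ pivotsˣ pivotsʸ , AllPairs-++⁺ clearˣ clearʸ cross

hasseRows-split : ∀ k a c d → hasseRows k a (c + d) ≡ hasseRows k a c ++ hasseRows k (a + c) d
hasseRows-split k a zero    d rewrite +-identityʳ a = refl
hasseRows-split k a (suc c) d rewrite hasseRows-split k (suc a) c d | +-suc a c = refl

hasseRows-pivots : ∀ k a c → All (λ e → a ≤ proj₁ e × proj₁ e < a + c) (hasseRows k a c)
hasseRows-pivots k a zero    = []
hasseRows-pivots k a (suc c) rewrite +-suc a c =
  (≤-refl , s≤s (m≤m+n a c)) ∷ All-map (λ { (a<i , i<) → <⇒≤ a<i , i< }) (hasseRows-pivots k (suc a) c)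

hasseRows-below : ∀ k a c {x} → x < a → All (Vanishes x) (hasseRows k a c)
hasseRows-below k a zero    x<a = []
hasseRows-below k a (suc c) x<a = hasse-below k x<a ∷ hasseRows-below k (suc a) c (≤-trans x<a (n≤1+n a))

hasseRows-far : ∀ k a c {x} → a + c ≤ k → a + c < x → All (Vanishes x) (hasseRows k a c)
hasseRows-far k a zero    a+c≤k a+c<x = []
hasseRows-far k a (suc c) a+c≤k a+c<x rewrite +-suc a c =
  hasse-far k (≤-trans (s≤s (m≤m+n a c)) a+c≤k) (≤-trans (s≤s (s≤s (m≤m+n a c))) a+c<x) ∷
  hasseRows-far k (suc a) c a+c≤k a+c<x

hasseRows-triangular : ∀ k a c → Triangular (hasseRows k a c)
hasseRows-triangular k a zero    = [] , []
hasseRows-triangular k a (suc c) with hasseRows-triangular k (suc a) c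
... | pivots , clears = hasse-self k a ∷ pivots , hasseRows-below k (suc a) c ≤-refl ∷ clears

-- The exchange for the rows with pivots p, p+1, p+2 of G_Λ's factor, below an arbitrary first row r.
module HasseExchange {K} {A : Adj (3 + K)} {r : Row} (p′ e : ℕ) (K≡ : K ≡ suc (p′ + e))
  (A≋ : HasGram A ((0 , r) ∷ hasseRows K 1 (2 + K))) (r₀ : r 0 ≡ true) where

  p : ℕ
  p = suc p′

  a b c : Row
  a = hasseRow K p
  b = hasseRow K (suc p)
  c = hasseRow K (suc (suc p))

  L₁ L₂ : List (ℕ × Row)
  L₁ = hasseRows K 1 p′
  L₂ = hasseRows K (3 + p) e

  p≤K : p ≤ K
  p≤K = subst (p ≤_) (sym K≡) (s≤s (m≤m+n p′ e))

  split : hasseRows K 1 (2 + K) ≡ L₁ ++ (p , a) ∷ (suc p , b) ∷ (suc (suc p) , c) ∷ L₂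
  split = trans (cong (hasseRows K 1) length≡) (hasseRows-split K 1 p′ (3 + e))
    where
    length≡ : 2 + K ≡ p′ + (3 + e)
    length≡ = trans (cong (2 +_) K≡) (sym (trans (+-suc p′ (2 + e)) (cong suc (trans (+-suc p′ (1 + e)) (cong suc (+-suc p′ e))))))

  A≋abc : HasGram A ((0 , r) ∷ (0 , a) ∷ (0 , b) ∷ (0 , c) ∷ L₁ ++ L₂)
  A≋abc x y = trans (A≋ x y) (trans (cong (λ L → gram ((0 , r) ∷ L) (toℕ x) (toℕ y)) split)
    (gram-↭ (↭.prep (0 , r) (shifts L₁ ((p , a) ∷ (suc p , b) ∷ (suc (suc p) , c) ∷ []))) (toℕ x) (toℕ y)))

  A≋acb : HasGram A ((0 , r) ∷ (0 , a) ∷ (0 , c) ∷ (0 , b) ∷ L₁ ++ L₂)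
  A≋acb x y = trans (A≋abc x y) (cong (λ g → (r (toℕ x) ∧ r (toℕ y)) xor ((a (toℕ x) ∧ a (toℕ y)) xor g))
                                      (gram-swap {0} {0} {0} {0} b c (L₁ ++ L₂) (toℕ x) (toℕ y)))

  vanish : ∀ {y z} → p < y → y ≤ 2 + p → p < z → z ≤ 2 + p → ∀ x → x ≡ 0 ⊎ x ≡ y ⊎ x ≡ z → All (Vanishes x) (L₁ ++ L₂)
  vanish _   _   _   _   x (inj₁ refl)        = All-++⁺ (hasseRows-below K 1 p′ (s≤s z≤n)) (hasseRows-below K (3 + p) e (s≤s z≤n))
  vanish p<y y≤  _   _   x (inj₂ (inj₁ refl)) = All-++⁺ (hasseRows-far K 1 p′ p≤K p<y) (hasseRows-below K (3 + p) e (s≤s y≤))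
  vanish _   _   p<z z≤  x (inj₂ (inj₂ refl)) = All-++⁺ (hasseRows-far K 1 p′ p≤K p<z) (hasseRows-below K (3 + p) e (s≤s z≤))

  rest-triangular : ∀ {w} → w p ≡ true → (∀ q → q < p → w q ≡ false) → Triangular (L₁ ++ (p , w) ∷ L₂)
  rest-triangular {w} wp w-below = Triangular-++ {L₁} {(p , w) ∷ L₂} (hasseRows-triangular K 1 p′)
    (wp ∷ proj₁ (hasseRows-triangular K (3 + p) e) , hasseRows-below K (3 + p) e (s≤s (≤-trans (n≤1+n p) (n≤1+n (suc p)))) ∷ proj₂ (hasseRows-triangular K (3 + p) e))
    (All-map (λ { (_ , q<p) → w-below _ q<p ∷ hasseRows-below K (3 + p) e (≤-trans q<p (≤-trans (n≤1+n p) (≤-trans (n≤1+n _) (n≤1+n _)))) })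
             (hasseRows-pivots K 1 p′))

  rest-bounded : ∀ {w} → All (λ e → proj₁ e ≤ 2 + K) (L₁ ++ (p , w) ∷ L₂)
  rest-bounded = All-++⁺ (All-map (λ { (_ , q<p) → ≤-trans (<⇒≤ q<p) p≤2+K }) (hasseRows-pivots K 1 p′))
                         (p≤2+K ∷ All-map (λ { (_ , q<) → ≤-pred (subst (λ k → _ < 3 + k) (sym K≡) q<) }) (hasseRows-pivots K (3 + p) e))
    where
    p≤2+K : p ≤ 2 + K
    p≤2+K = ≤-trans p≤K (≤-trans (n≤1+n K) (n≤1+n (suc K)))

  below-p : ∀ {i q} → p ≤ i → q < p → hasseRow K i q ≡ false
  below-p p≤i q<p = hasse-below K (≤-trans q<p p≤i)

  sum-pivot : ∀ {x₁ x₂ x₃ : Row} → x₁ p ≡ true → x₂ p ≡ false → x₃ p ≡ false → (x₁ ⊕ (x₂ ⊕ x₃)) p ≡ true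
  sum-pivot e₁ e₂ e₃ rewrite e₁ | e₂ | e₃ = refl

  sum-below : ∀ {x₁ x₂ x₃ : Row} → (∀ q → q < p → x₁ q ≡ false) → (∀ q → q < p → x₂ q ≡ false) → (∀ q → q < p → x₃ q ≡ false) →
    ∀ q → q < p → (x₁ ⊕ (x₂ ⊕ x₃)) q ≡ false
  sum-below e₁ e₂ e₃ q q<p rewrite e₁ q q<p | e₂ q q<p | e₃ q q<p = refl

  a-below : ∀ q → q < p → a q ≡ false
  a-below q = below-p {p} {q} ≤-refl
  b-below : ∀ q → q < p → b q ≡ false
  b-below q = below-p {suc p} {q} (n≤1+n p)
  c-below : ∀ q → q < p → c q ≡ false
  c-below q = below-p {suc (suc p)} {q} (≤-trans (n≤1+n p) (n≤1+n (suc p)))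

  bᵖ : b p ≡ false
  bᵖ = hasse-below K {suc p} {p} ≤-refl
  cᵖ : c p ≡ false
  cᵖ = hasse-below K {suc (suc p)} {p} (n≤1+n (suc p))

  p+1≤2+K : suc p ≤ 2 + K
  p+1≤2+K = s≤s (≤-trans p≤K (n≤1+n K))
  p+2≤2+K : suc (suc p) ≤ 2 + K
  p+2≤2+K = s≤s (s≤s p≤K)

  aᶠ : p ≡ K → a (suc (suc p)) ≡ true
  aᶠ p≡K = subst (λ q → hasseRow K q (suc (suc q)) ≡ true) (sym p≡K) (hasse-fork K)

  bᶠ : p ≡ K → b (suc (suc p)) ≡ false
  bᶠ p≡K = subst (λ q → hasseRow K (suc q) (suc (suc q)) ≡ false) (sym p≡K) (hasse-fork-next K)

  successful-from-p+1 : b (suc (suc p)) ≡ not (a (suc (suc p))) → r (suc p) ≡ true →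
    ∃[ σ ] Successful A (clamp (2 + K) (suc p) ∷ σ)
  successful-from-p+1 bᶻ rʸ = Exchange.successful-from-y {u = r} {a} {b} {c} L₁ L₂ {p} {suc p} {suc (suc p)} A≋abc
    (rest-triangular (sum-pivot {a} {b} {c} (hasse-self K p) bᵖ cᵖ) (sum-below {a} {b} {c} a-below b-below c-below))
    rest-bounded p+1≤2+K p+2≤2+K
    (vanish ≤-refl (n≤1+n _) (n≤1+n _) ≤-refl)
    r₀ (a-below 0 (s≤s z≤n)) (b-below 0 (s≤s z≤n)) (c-below 0 (s≤s z≤n))
    rʸ (hasse-next K p≤K) (hasse-self K (suc p)) (hasse-below K {suc (suc p)} {suc p} ≤-refl)
    bᶻ (hasse-self K (suc (suc p)))

  successful-from-p+2 : p ≡ K → r (suc (suc p)) ≡ true → ∃[ σ ] Successful A (clamp (2 + K) (suc (suc p)) ∷ σ)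
  successful-from-p+2 p≡K rʸ = Exchange.successful-from-y {u = r} {a} {c} {b} L₁ L₂ {p} {suc (suc p)} {suc p} A≋acb
    (rest-triangular (sum-pivot {a} {c} {b} (hasse-self K p) cᵖ bᵖ) (sum-below {a} {c} {b} a-below c-below b-below))
    rest-bounded p+2≤2+K p+1≤2+K
    (vanish (n≤1+n _) ≤-refl ≤-refl (n≤1+n _))
    r₀ (a-below 0 (s≤s z≤n)) (c-below 0 (s≤s z≤n)) (b-below 0 (s≤s z≤n))
    rʸ (aᶠ p≡K) (hasse-self K (suc (suc p))) (bᶠ p≡K)
    (trans (hasse-below K {suc (suc p)} {suc p} ≤-refl) (cong not (sym (hasse-next K p≤K)))) (hasse-self K (suc p))

-- Uniqueness

starts-zero⇒¬starts-suc : ∀ {n} {A : Adj (suc n)} {x} → (∀ {σ} → Successful A σ → ∃[ vs ] (σ ≡ zero ∷ vs)) →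
  ∃[ σ ] Successful A (suc x ∷ σ) → ⊥
starts-zero⇒¬starts-suc starts-zero (_ , s) with starts-zero s
... | _ , ()

-- A neighbour j ≥ 3 of vertex 1 (paper labels) would give a successful sequence starting at j.
no-far-neighbour : ∀ m′ {A : Adj (4 + m′)} → (∀ {σ} → Successful A σ → ∃[ vs ] (σ ≡ zero ∷ vs)) →
  HasGram A ((0 , A zero ∘ clamp (3 + m′)) ∷ hasseRows (suc m′) 1 (3 + m′)) → A zero zero ≡ true →
  ∀ kk → A zero (suc (suc kk)) ≡ false
no-far-neighbour m′ {A} starts-zero A≋ loop₀ kk with A zero (suc (suc kk)) in e
... | false = refl
... | true with <-cmp (toℕ kk) m′
...   | tri< t<m′ _ _ = ⊥-elim (starts-zero⇒¬starts-suc starts-zero (E.successful-from-p+1 bᶻ rʸ))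
  where
  t = toℕ kk
  d = proj₁ (m≤n⇒∃[o]m+o≡n t<m′)
  module E = HasseExchange {suc m′} {A} {A zero ∘ clamp (3 + m′)} t (suc d)
    (cong suc (trans (sym (proj₂ (m≤n⇒∃[o]m+o≡n t<m′))) (sym (+-suc t d)))) A≋ loop₀
  bᶻ : hasseRow (suc m′) (suc (suc t)) (suc (suc (suc t))) ≡ not (hasseRow (suc m′) (suc t) (suc (suc (suc t))))
  bᶻ = trans (hasse-next (suc m′) (s≤s t<m′)) (cong not (sym (hasse-far (suc m′) {suc t} {suc (suc (suc t))} (s≤s t<m′) ≤-refl)))
  rʸ = trans (cong (A zero) (clamp-toℕ (3 + m′) (suc (suc kk)))) e
...   | tri≈ _ t≡m′ _ = ⊥-elim (starts-zero⇒¬starts-suc starts-zero (E.successful-from-p+1 bᶻ rʸ))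
  where
  module E = HasseExchange {suc m′} {A} {A zero ∘ clamp (3 + m′)} m′ 0 (cong suc (sym (+-identityʳ m′))) A≋ loop₀
  bᶻ = trans (hasse-fork-next (suc m′)) (cong not (sym (hasse-fork (suc m′))))
  rʸ = subst (λ t → A zero (clamp (3 + m′) (suc (suc t))) ≡ true) t≡m′ (trans (cong (A zero) (clamp-toℕ (3 + m′) (suc (suc kk)))) e)
...   | tri> _ _ m′<t = ⊥-elim (starts-zero⇒¬starts-suc starts-zero (E.successful-from-p+2 refl rʸ))
  where
  module E = HasseExchange {suc m′} {A} {A zero ∘ clamp (3 + m′)} m′ 0 (cong suc (sym (+-identityʳ m′))) A≋ loop₀
  t≡ : toℕ kk ≡ suc m′
  t≡ = ≤-antisym (≤-pred (toℕ<n kk)) m′<t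
  rʸ = subst (λ t → A zero (clamp (3 + m′) (suc (suc t))) ≡ true) t≡ (trans (cong (A zero) (clamp-toℕ (3 + m′) (suc (suc kk)))) e)

loops2-≋ : ∀ {B : Adj 2} → SymmetricAdj B → B zero (suc zero) ≡ false → B zero zero ≡ true → B (suc zero) (suc zero) ≡ true →
  B ≋ loops2
loops2-≋ sym-B no-edge loop₀ loop₁ zero       zero       = loop₀
loops2-≋ sym-B no-edge loop₀ loop₁ zero       (suc zero) = no-edge
loops2-≋ sym-B no-edge loop₀ loop₁ (suc zero) zero       = trans (sym-B (suc zero) zero) no-edge
loops2-≋ sym-B no-edge loop₀ loop₁ (suc zero) (suc zero) = loop₁

-- An edge from the first pressed vertex to the second would put the second below the first.
two-loops : ∀ {B : Adj 2} {v w} → v ≢ w → Successful B (v ∷ w ∷ []) → InstrIs B (v ∷ w ∷ []) (Lam 2) →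
  B v w ≡ false × B v v ≡ true × B w w ≡ true
two-loops {B} {v} {w} v≢w (step loopᵛ (step loopʷ _)) isLam2 = no-edge , loopᵛ , loop
  where
  no-edge : B v w ≡ false
  no-edge with B v w in e
  ... | false = refl
  ... | true  = ⊥-elim (v≢w (Lam2-discrete (Equivalence.to (isLam2 v w) (first e (there (here refl)) ◅ ε))))
  loop : B w w ≡ true
  loop = trans (sym (xor-identityʳ (B w w))) (subst (λ b → B w w xor (b ∧ b) ≡ true) no-edge loopʷ)

loops2-unique : ∀ {B : Adj 2} {τ} → SymmetricAdj B → Successful B τ → (∀ x → x ∈ τ) → InstrIs B τ (Lam 2) → B ≋ loops2
loops2-unique sym-B s covers isLam2 with Unique-covering⇒TwoOrders (Successful⇒Unique sym-B s) covers
... | inj₁ refl with two-loops (λ ()) s isLam2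
...   | no-edge , loop₀ , loop₁ = loops2-≋ sym-B no-edge loop₀ loop₁
loops2-unique sym-B s covers isLam2 | inj₂ refl with two-loops (λ ()) s isLam2
...   | no-edge , loop₁ , loop₀ = loops2-≋ sym-B (trans (sym-B zero (suc zero)) no-edge) loop₀ loop₁

module Reduction {m} {A : Adj (3 + m)} (sym-A : SymmetricAdj A) (sfrak : SfrakIsLam (3 + m) A) where

  isLam : ∀ {σ} → Successful A σ → InstrIs A σ (Lam (3 + m))
  isLam s x y = ⇔-trans (⇔-sym instr⇔Path) (proj₂ sfrak _ s x y)

  starts-zero : ∀ {σ} → Successful A σ → ∃[ vs ] (σ ≡ zero ∷ vs)
  starts-zero s = Successful-starts-zero sym-A s (isLam s)

  σ₀ : List (Fin (3 + m))
  σ₀ = zero ∷ proj₁ (starts-zero (proj₂ (proj₁ sfrak)))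

  s₀ : Successful A σ₀
  s₀ = subst (Successful A) (proj₂ (starts-zero (proj₂ (proj₁ sfrak)))) (proj₂ (proj₁ sfrak))

  loop₀ : A zero zero ≡ true
  loop₀ with s₀
  ... | step loop _ = loop

  B : Adj (2 + m)
  B x y = press A zero (suc x) (suc y)

  reduces : press A zero ≋ addIsolated B
  reduces zero    y       = press-isolates {A = A} zero loop₀ y
  reduces (suc x) zero    = trans (press-symmetric zero sym-A (suc x) zero) (press-isolates {A = A} zero loop₀ (suc x))
  reduces (suc x) (suc y) = refl

  open FirstPressed {A = A} {B = B} reduces

  B-symmetric : SymmetricAdj B
  B-symmetric x y = press-symmetric zero sym-A (suc x) (suc y)

  τ₀ : List (Fin (2 + m))
  τ₀ = proj₁ (Successful-uncons s₀)

  t₀ : Successful B τ₀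
  t₀ = proj₂ (proj₂ (Successful-uncons s₀))

  s₁ : Successful A (zero ∷ map suc τ₀)
  s₁ = Successful-cons loop₀ t₀

  B-isLam : ∀ {τ} → Successful B τ → InstrIs B τ (Lam (2 + m))
  B-isLam t = InstrIs-uncons reduces (isLam (Successful-cons loop₀ t))

  B-SfrakIsLam : SfrakIsLam (2 + m) B
  B-SfrakIsLam = (τ₀ , t₀) , λ τ t x y → ⇔-trans instr⇔Path (B-isLam t x y)

  B-covers : ∀ x → x ∈ τ₀
  B-covers x with InstrIs-Lam-covers (isLam s₁) (suc x)
  ... | there x∈ = suc∈map-suc x∈

  A≋attach : A ≋ attach B (A zero)
  A≋attach = ≋attach reduces

  first-row-reaches : ∀ b → Σ (Fin (2 + m)) λ c → A zero (suc c) ≡ true × Lam (2 + m) b c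
  first-row-reaches b = reach (Equivalence.from (isLam s₁ zero (suc b)) (Lam-zero-greatest m (suc b)))
    where
    reach : Path A (zero ∷ map suc τ₀) zero (suc b) → Σ (Fin (2 + m)) λ c → A zero (suc c) ≡ true × Lam (2 + m) b c
    reach (first {y = zero}  _ _ ◅ p) = reach p
    reach (first {y = suc c} e _ ◅ p) = c , e , Equivalence.to (B-isLam t₀ c b) (Equivalence.to Path-shift⇔ p)
    reach (later arc ◅ p) = ⊥-elim (zero∉map-suc τ₀ (Arc′-source∈ arc))

first-row : ∀ m {A : Adj (3 + m)} (sym-A : SymmetricAdj A) (sfrak : SfrakIsLam (3 + m) A) →
  Reduction.B sym-A sfrak ≋ GLam⁻ m → ∀ x → A zero x ≡ topRow m x
first-row zero sym-A sfrak _ zero = loop₀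
  where open Reduction sym-A sfrak
first-row zero sym-A sfrak _ (suc b) with Reduction.first-row-reaches sym-A sfrak b
... | c , e , l with Lam2-discrete l
...   | refl = e
first-row (suc m) sym-A sfrak _ zero = loop₀
  where open Reduction sym-A sfrak
first-row (suc m) sym-A sfrak _ (suc zero) with Reduction.first-row-reaches sym-A sfrak zero
... | c , e , l with Lam-below-zero l
...   | refl = e
first-row (suc m) {A} sym-A sfrak B≋ (suc (suc k)) = no-far-neighbour m starts-zero A≋gram loop₀ k
  where
  open Reduction sym-A sfrak
  A≋gram : HasGram A ((0 , A zero ∘ clamp (3 + m)) ∷ hasseRows (suc m) 1 (3 + m))
  A≋gram = HasGram-resp {L = (0 , A zero ∘ clamp (3 + m)) ∷ hasseRows (suc m) 1 (3 + m)}
    (≋-sym (≋-trans A≋attach (attach-cong {r = A zero} B≋ (λ _ → refl))))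
    (HasGram-attach {r′ = A zero ∘ clamp (3 + m)} {L = hasseRows (suc m) 1 (3 + m)}
      (addIsolated-GLam-hasGram m) (λ x → cong (A zero) (clamp-toℕ (3 + m) x)))

GLam-unique      : ∀ m {A : Adj (3 + m)} → SymmetricAdj A → SfrakIsLam (3 + m) A → A ≋ GLam (3 + m)
remainder-unique : ∀ m {A : Adj (3 + m)} (sym-A : SymmetricAdj A) (sfrak : SfrakIsLam (3 + m) A) →
  Reduction.B sym-A sfrak ≋ GLam⁻ m
GLam-unique m sym-A sfrak = ≋-trans A≋attach
  (≋-trans (attach-cong B≋ (first-row m sym-A sfrak B≋)) (≋-sym (GLam-attach m)))
  where
  open Reduction sym-A sfrak
  B≋ : B ≋ GLam⁻ m
  B≋ = remainder-unique m sym-A sfrak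

remainder-unique zero    sym-A sfrak = loops2-unique B-symmetric t₀ B-covers (B-isLam t₀)
  where open Reduction sym-A sfrak
remainder-unique (suc m) sym-A sfrak = GLam-unique m B-symmetric B-SfrakIsLam
  where open Reduction sym-A sfrak

mainTheorem9 : (n : ℕ) → 3 ≤ n →
    Autonomous (Lam n) ×
    SfrakIsLam n (GLam n) ×
    (∀ (A : Adj n) → SymmetricAdj A → SfrakIsLam n A → ∀ x y → A x y ≡ GLam n x y)
mainTheorem9 (suc (suc (suc m))) (s≤s (s≤s (s≤s z≤n))) =
  Lam-autonomous m , GLam-SfrakIsLam m , λ A sym-A sfrak → GLam-unique m sym-A sfrak
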